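{- Let $D$ be a digraph with $m$ arcs and minimum outdegree $d\ge 4$, and let $X,Y$ be a partition of $V(D)$ with $e(X)=0$. Let $\theta=\min\{|\theta(X_1,X_2)| : X_1,X_2 \text{ is a partition of } X\}$, and let $X'=\{x\in X : s(x)\ge \theta\}$. Let $\varepsilon>0$ be such that $\max_{y\in Y} d(y)\le \varepsilon^2 m/4$. Then there exists a partition $V_1,V_2$ of $V(D)$ such that $\min\{e(V_1,V_2),e(V_2,V_1)\}\ge \left(\frac{d-1}{2(2d-1)}-\varepsilon\right)m$, or the following statements all hold: (1) $\theta> m/(2d-1)$; (2) $|X'|$ is an odd integer; (3) letting $g=\sum_{x\in X\setminus X'} s(x)$ and writing $X'=\{v_1,\dots,v_{2k+1}\}$ with $s(v_1)\ge s(v_2)\ge\dots\ge s(v_{2k+1})$, we have $\sum_{j=k+1}^{2k+1} s(v_j)-\sum_{j=1}^{k} s(v_j)\ge g+\theta$.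
   Context: All digraphs are finite and have no loops and no two parallel arcs in the same direction (arcs in opposite directions are allowed). For a digraph $D$ and $A,B\subseteq V(D)$, $e(A,B)$ is the number of arcs directed from a vertex of $A$ to a vertex of $B$, and $e(A)=e(A,A)$. For a vertex $x$, $d^+(x)$ and $d^-(x)$ are its outdegree and indegree, $d(x)=d^+(x)+d^-(x)$ is its degree, and $s(x)=\max\{d^+(x)-d^-(x),\,d^-(x)-d^+(x)\}=|d^+(x)-d^-(x)|$. Given a partition $X,Y$ of $V(D)$ and a partition $X_1,X_2$ of $X$ (parts may be empty), the gap is $\theta(X_1,X_2)=\big(e(X_1,Y)+e(Y,X_2)\big)-\big(e(X_2,Y)+e(Y,X_1)\big)$.
   Formalization: The parameter ε ranges over the positive rationals, both in the degree bound on Y and in the bound on the cuts. -}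

module Defs where

open import Data.Bool using (Bool; true; false; _∧_; not; if_then_else_)
open import Data.Nat as ℕ using (ℕ; zero; suc; _+_; _*_; _∸_; _≤_; _<_; ∣_-_∣)
open import Data.Integer as ℤ using (ℤ; +_)
open import Data.Rational as ℚ using (ℚ)
open import Data.Fin using (Fin)
open import Data.List using (List; map; allFin)
open import Data.Nat.ListAction using (sum)
open import Data.Product using (Σ; ∃; ∃-syntax; _×_; _,_)
open import Data.Sum using (_⊎_)
open import Relation.Binary.PropositionalEquality using (_≡_)
open import Function.Definitions using (Injective)

-- A digraph on vertex set Fin n: arc i j = true iff there is an arc i → j.
-- No loops; at most one arc per ordered pair (automatic for a Bool relation).
record Digraph : Set where
  field
    n        : ℕ
    arc      : Fin n → Fin n → Bool
    loopless : ∀ i → arc i i ≡ false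
open Digraph public

VSet : Digraph → Set
VSet D = Fin (n D) → Bool

Σ[_] : ∀ {k} → (Fin k → ℕ) → ℕ
Σ[_] {k} f = sum (map f (allFin k))

b2n : Bool → ℕ
b2n true  = 1
b2n false = 0

e : (D : Digraph) → VSet D → VSet D → ℕ
e D A B = Σ[ (λ i → Σ[ (λ j → b2n (A i ∧ B j ∧ arc D i j)) ] ) ]

full : (D : Digraph) → VSet D
full D _ = true

arcs : Digraph → ℕ
arcs D = e D (full D) (full D)

outdeg indeg deg s : (D : Digraph) → Fin (n D) → ℕ
outdeg D x = Σ[ (λ j → b2n (arc D x j)) ]
indeg  D x = Σ[ (λ i → b2n (arc D i x)) ]
deg    D x = outdeg D x + indeg D x
s      D x = ∣ outdeg D x - indeg D x ∣

card : (D : Digraph) → VSet D → ℕ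
card D A = Σ[ (λ i → b2n (A i)) ]

sumS : (D : Digraph) → VSet D → ℕ
sumS D A = Σ[ (λ i → if A i then s D i else 0) ]

_⊆_ : {D : Digraph} → VSet D → VSet D → Set
A ⊆ B = ∀ i → A i ≡ true → B i ≡ true

compl : {D : Digraph} → VSet D → VSet D
compl A i = not (A i)

_∖_ : {D : Digraph} → VSet D → VSet D → VSet D
(A ∖ B) i = A i ∧ not (B i)

ℤ[_] : ℕ → ℤ
ℤ[ k ] = + k

-- gap θ(X₁,X₂) with respect to Y = V(D) \ X; partitions of X are given by
-- X₁ ⊆ X and X₂ = X \ X₁.
gap : (D : Digraph) (X X₁ : VSet D) → ℤ
gap D X X₁ =
  let Y  = compl {D} X
      X₂ = _∖_ {D} X X₁
  in (ℤ[ e D X₁ Y ] ℤ.+ ℤ[ e D Y X₂ ]) ℤ.- (ℤ[ e D X₂ Y ] ℤ.+ ℤ[ e D Y X₁ ])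

IsMinGap : (D : Digraph) (X : VSet D) → ℕ → Set
IsMinGap D X θ =
  (Σ (VSet D) λ X₁ → (_⊆_ {D} X₁ X) × ℤ.∣ gap D X X₁ ∣ ≡ θ) ×
  (∀ (X₁ : VSet D) → _⊆_ {D} X₁ X → θ ≤ ℤ.∣ gap D X X₁ ∣)

MinOutdeg : Digraph → ℕ → Set
MinOutdeg D d = (∀ x → d ≤ outdeg D x) × (∃[ x ] outdeg D x ≡ d)

X′ : (D : Digraph) → VSet D → ℕ → VSet D
X′ D X θ x = X x ∧ (if θ ℕ.≤ᵇ s D x then true else false)

ℚ[_] : ℕ → ℚ
ℚ[ k ] = (+ k) ℚ./ 1

-- The partition V₁, V₂ = V(D) \ V₁ satisfies
--   min{e(V₁,V₂), e(V₂,V₁)} ≥ ((d-1)/(2(2d-1)) - ε) m,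
-- written after multiplying by the positive number 2(2d-1).
GoodCut : (D : Digraph) (d : ℕ) (ε : ℚ) → VSet D → Set
GoodCut D d ε V₁ =
  let V₂ = compl {D} V₁
      c  = 2 * (2 * d ∸ 1)
      rhs = (ℚ[ d ∸ 1 ] ℚ.- ℚ[ c ] ℚ.* ε) ℚ.* ℚ[ arcs D ]
  in (rhs ℚ.≤ ℚ[ c ] ℚ.* ℚ[ e D V₁ V₂ ]) × (rhs ℚ.≤ ℚ[ c ] ℚ.* ℚ[ e D V₂ V₁ ])

-- Conditions (2) and (3): |X'| = 2k+1, and for the enumeration
-- v₁,…,v_{2k+1} of X' (here v : Fin (2k+1) → V, index j ↦ v_{j+1}) with
-- s nonincreasing, ∑_{j=k+1}^{2k+1} s(v_j) − ∑_{j=1}^{k} s(v_j) ≥ g + θ.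
open import Data.Fin using (toℕ)

SortedEnum : (D : Digraph) (A : VSet D) (k : ℕ) → (Fin k → Fin (n D)) → Set
SortedEnum D A k v =
  Injective _≡_ _≡_ v ×
  (∀ j → A (v j) ≡ true) ×
  (∀ x → A x ≡ true → ∃[ j ] v j ≡ x) ×
  (∀ i j → toℕ i ≤ toℕ j → s D (v j) ≤ s D (v i))

Cond23 : (D : Digraph) (X : VSet D) (θ : ℕ) → Set
Cond23 D X θ =
  let X' = X′ D X θ
      g  = sumS D (_∖_ {D} X X')
  in Σ ℕ λ k → (card D X' ≡ 2 * k + 1) ×
     (∀ (v : Fin (2 * k + 1) → Fin (n D)) → SortedEnum D X' (2 * k + 1) v →
        let top = Σ[ (λ j → if toℕ j ℕ.<ᵇ k then s D (v j) else 0) ]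
            bot = Σ[ (λ j → if toℕ j ℕ.<ᵇ k then 0 else s D (v j)) ]
        in ℤ[ g ] ℤ.+ ℤ[ θ ] ℤ.≤ ℤ[ bot ] ℤ.- ℤ[ top ])

-- If θ(2d − 1) ≤ m, start from a partition X₁, X₂ of X attaining θ and place the vertices of
-- Y = V(D) ∖ X one at a time by the method of conditional expectations. The expected values of
-- 4e(V, V̄) and 4e(V̄, V) start at m + gap and m − gap, every placement of y moves them by at most
-- 2 deg(y) while the two choices average out, so some choice keeps the sum of the squared
-- deviations below 8 Σ deg(y)² ≤ 16Mm ≤ 4ε²m². Both cuts are then at least (m − θ − 2εm)/4.
-- If m < θ(2d − 1), every x ∈ X has s(x) ≤ |Y| ≤ m/d < 2θ, and the gaps of the partitions of X
-- are exactly the signed sums of the s(x). Pairing off the vertices with s(x) ≥ θ and then adding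
-- the remaining ones with suitable signs would reach a signed sum strictly between −θ and θ, unless
-- |X'| is odd and the unpaired vertex outweighs all the others, which is condition (3).
module Submission where

open import Algebra.Bundles using (CommutativeMonoid)
open import Data.Bool using (Bool; true; false; _∧_; _∨_; not; if_then_else_; T)
import Data.Bool.Properties as BP
open import Data.Empty using (⊥-elim)
open import Data.Fin using (Fin; zero; suc; toℕ; _↑ˡ_; _↑ʳ_; _≟_)
import Data.Fin.Properties as FP
open import Data.Integer as Int using (ℤ; +_; -_)
import Data.Integer.Properties as ZP
import Data.Integer.Tactic.RingSolver as IntSolver
open import Data.List using (tabulate)
import Data.List.Properties as LP
open import Data.Nat as Nat using (ℕ; zero; suc; z≤n; s≤s; _∸_)
import Data.Nat.Coprimality as Coprime
import Data.Nat.ListAction as ListAction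
import Data.Nat.Properties as NP
import Data.Nat.Tactic.RingSolver as NatSolver
open import Data.Product using (Σ; ∃; _×_; _,_; proj₁; proj₂)
open import Data.Rational as ℚ using (ℚ; Positive)
import Data.Rational.Properties as QP
open import Data.Sum using (_⊎_; inj₁; inj₂)
open import Data.Vec.Functional using (Vector; updateAt; _++_)
import Data.Vec.Functional.Properties as VP
open import Function using (_∘_; id; const; case_of_)
open import Function.Definitions using (Injective)
open import Relation.Binary.PropositionalEquality
  using (_≡_; _≢_; refl; sym; trans; cong; cong₂; subst; subst₂; module ≡-Reasoning)
open import Relation.Nullary using (Dec; does; ¬_; yes; no)
open import Relation.Nullary.Decidable using (dec-true; dec-false)

open import Defs

-- Positions 0 … 2k + r − 1 split into k pairs (i, k + i) followed by r extra positions.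
module PairedPositions (k r : ℕ) where
  first second : Fin k → Fin (2 Nat.* k Nat.+ r)
  first  i = (i ↑ˡ (k Nat.+ 0)) ↑ˡ r
  second i = (k ↑ʳ (i ↑ˡ 0)) ↑ˡ r

  extra : Fin r → Fin (2 Nat.* k Nat.+ r)
  extra i = (2 Nat.* k) ↑ʳ i

module FinSum {c ℓ} (M : CommutativeMonoid c ℓ) where
  open CommutativeMonoid M
    using (Carrier; _≈_; _∙_; ε; ∙-congˡ; ∙-congʳ; identityˡ; identityʳ; assoc)
    renaming (sym to ≈-sym; trans to ≈-trans)
  open import Algebra.Properties.CommutativeMonoid.Sum M public

  sum-↑ : ∀ a b (f : Vector Carrier (a Nat.+ b)) →
          sum f ≈ sum (λ i → f (i ↑ˡ b)) ∙ sum (λ j → f (a ↑ʳ j))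
  sum-↑ zero    b f = ≈-sym (identityˡ _)
  sum-↑ (suc a) b f = ≈-trans (∙-congˡ (sum-↑ a b (f ∘ suc))) (≈-sym (assoc _ _ _))

  sum-paired : ∀ k r (f : Vector Carrier (2 Nat.* k Nat.+ r)) → let open PairedPositions k r in
               sum f ≈ (sum (f ∘ first) ∙ sum (f ∘ second)) ∙ sum (f ∘ extra)
  sum-paired k r f = ≈-trans (sum-↑ (2 Nat.* k) r f) (∙-congʳ (≈-trans (sum-↑ k (k Nat.+ 0) (λ j → f (j ↑ˡ r)))
                       (∙-congˡ (≈-trans (sum-↑ k 0 (λ j → f ((k ↑ʳ j) ↑ˡ r))) (identityʳ _)))))

  sum-if : ∀ {k} b (f : Vector Carrier k) → sum (λ i → if b then f i else ε) ≈ (if b then sum f else ε)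
  sum-if         true  f = CommutativeMonoid.refl M
  sum-if {k}     false f = sum-replicate-zero k

  sum-indicator : ∀ {k} (x : Fin k) (f : Vector Carrier k) →
                  sum (λ i → if does (i ≟ x) then f i else ε) ≈ f x
  sum-indicator {suc k} zero f = ≈-trans (∙-congˡ (sum-replicate-zero k)) (identityʳ _)
  sum-indicator (suc x)    f = ≈-trans (identityˡ _) (sum-indicator x (f ∘ suc))

module ℕΣ where
  open Nat using (_+_; _≤_)
  open FinSum NP.+-0-commutativeMonoid public
  open import Algebra.Properties.Semiring.Sum NP.+-*-semiring public using (*-distribˡ-sum)

  sum-mono-≤ : ∀ {k} {f g : Vector ℕ k} → (∀ i → f i ≤ g i) → sum f ≤ sum g
  sum-mono-≤ {zero}  f≤g = z≤n
  sum-mono-≤ {suc k} f≤g = NP.+-mono-≤ (f≤g zero) (sum-mono-≤ (f≤g ∘ suc))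

  sum≡0⇒≡0 : ∀ {k} (f : Vector ℕ k) → sum f ≡ 0 → ∀ i → f i ≡ 0
  sum≡0⇒≡0 f Σf≡0 zero    = NP.m+n≡0⇒m≡0 (f zero) Σf≡0
  sum≡0⇒≡0 f Σf≡0 (suc i) = sum≡0⇒≡0 (f ∘ suc) (NP.m+n≡0⇒n≡0 (f zero) Σf≡0) i

  Σ[]≡sum : ∀ {k} (f : Fin k → ℕ) → Σ[ f ] ≡ sum f
  Σ[]≡sum {k} f = trans (cong ListAction.sum (LP.map-tabulate id f)) (sum-tabulate f)
    where
    sum-tabulate : ∀ {k} (f : Fin k → ℕ) → ListAction.sum (tabulate f) ≡ sum f
    sum-tabulate {zero}  f = refl
    sum-tabulate {suc k} f = cong (λ t → f zero + t) (sum-tabulate (f ∘ suc))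

module ℤΣ where
  open FinSum ZP.+-0-commutativeMonoid public

  pos-sum : ∀ {k} (f : Vector ℕ k) → + ℕΣ.sum f ≡ sum (+_ ∘ f)
  pos-sum {zero}  f = refl
  pos-sum {suc k} f = trans (ZP.pos-+ (f zero) _) (cong (λ t → + f zero Int.+ t) (pos-sum (f ∘ suc)))

  neg-sum : ∀ {k} (f : Vector ℤ k) → - sum f ≡ sum (-_ ∘ f)
  neg-sum {zero}  f = refl
  neg-sum {suc k} f = trans (ZP.neg-distrib-+ (f zero) _) (cong (λ t → - f zero Int.+ t) (neg-sum (f ∘ suc)))

  pos-sum-+ : ∀ {k} (a b : Fin k → ℕ) → + ℕΣ.sum a Int.+ + ℕΣ.sum b ≡ sum (λ x → + a x Int.+ + b x)
  pos-sum-+ a b = trans (cong₂ Int._+_ (pos-sum a) (pos-sum b)) (sym (∑-distrib-+ (+_ ∘ a) (+_ ∘ b)))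

  sum-minus : ∀ {k} (f g : Fin k → ℤ) → sum f Int.- sum g ≡ sum (λ x → f x Int.- g x)
  sum-minus f g = trans (cong (λ t → sum f Int.+ t) (neg-sum g)) (sym (∑-distrib-+ f (-_ ∘ g)))

even-or-odd : ∀ c → ∃ λ k → (c ≡ 2 Nat.* k Nat.+ 0) ⊎ (c ≡ 2 Nat.* k Nat.+ 1)
even-or-odd zero    = 0 , inj₁ refl
even-or-odd (suc c) with even-or-odd c
... | k , inj₁ c≡2k   = k , inj₂ (trans (cong suc c≡2k) (lemma₁ k))
  where
  lemma₁ : ∀ k → suc (2 Nat.* k Nat.+ 0) ≡ 2 Nat.* k Nat.+ 1
  lemma₁ = NatSolver.solve-∀
... | k , inj₂ c≡2k+1 = suc k , inj₁ (trans (cong suc c≡2k+1) (lemma₂ k))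
  where
  lemma₂ : ∀ k → suc (2 Nat.* k Nat.+ 1) ≡ 2 Nat.* suc k Nat.+ 0
  lemma₂ = NatSolver.solve-∀

-- the bound is a value of f, or 0
uniform-bound : ∀ {k} (P : ℕ → Set) (f : Fin k → ℕ) → P 0 → (∀ i → P (f i)) → Σ ℕ λ M → P M × (∀ i → f i Nat.≤ M)
uniform-bound {zero}  P f P0 _  = 0 , P0 , λ ()
uniform-bound {suc k} P f P0 Pf = extend (uniform-bound P (f ∘ suc) P0 (Pf ∘ suc))
  where
  extend : (Σ ℕ λ M → P M × (∀ i → f (suc i) Nat.≤ M)) → Σ ℕ λ M → P M × (∀ i → f i Nat.≤ M)
  extend (M , PM , bound) with f zero Nat.≤? M
  ... | yes f0≤M = M , PM , λ { zero → f0≤M ; (suc i) → bound i }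
  ... | no  f0≰M = f zero , Pf zero , λ { zero → NP.≤-refl ; (suc i) → NP.≤-trans (bound i) (NP.<⇒≤ (NP.≰⇒> f0≰M)) }

module _ where
  open Nat using (_+_; _*_; _≤_)

  sum² : ∀ {k} → (Fin k → Fin k → ℕ) → ℕ
  sum² f = ℕΣ.sum (λ i → ℕΣ.sum (f i))

  sum²-cong : ∀ {k} {f g : Fin k → Fin k → ℕ} → (∀ i j → f i j ≡ g i j) → sum² f ≡ sum² g
  sum²-cong {k} f≗g = ℕΣ.sum-cong-≗ {k} (λ i → ℕΣ.sum-cong-≗ {k} (f≗g i))

  sum²-distrib-+ : ∀ {k} (f g : Fin k → Fin k → ℕ) → sum² (λ i j → f i j + g i j) ≡ sum² f + sum² g
  sum²-distrib-+ {k} f g = trans (ℕΣ.sum-cong-≗ {k} (λ i → ℕΣ.∑-distrib-+ (f i) (g i)))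
                                 (ℕΣ.∑-distrib-+ (ℕΣ.sum ∘ f) (ℕΣ.sum ∘ g))

  *-distribˡ-sum² : ∀ {k} c (f : Fin k → Fin k → ℕ) → c * sum² f ≡ sum² (λ i j → c * f i j)
  *-distribˡ-sum² {k} c f =
    trans (ℕΣ.*-distribˡ-sum c (ℕΣ.sum ∘ f)) (ℕΣ.sum-cong-≗ {k} (λ i → ℕΣ.*-distribˡ-sum c (f i)))

  sum²-distrib-+₃ : ∀ {k} (f g h : Fin k → Fin k → ℕ) →
                    sum² (λ i j → f i j + (g i j + h i j)) ≡ sum² f + (sum² g + sum² h)
  sum²-distrib-+₃ f g h = trans (sum²-distrib-+ f _) (cong (λ t → sum² f + t) (sum²-distrib-+ g h))

  sum²-mono-≤ : ∀ {k} {f g : Fin k → Fin k → ℕ} → (∀ i j → f i j ≤ g i j) → sum² f ≤ sum² g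
  sum²-mono-≤ f≤g = ℕΣ.sum-mono-≤ (λ i → ℕΣ.sum-mono-≤ (f≤g i))

  e≡sum² : (D : Digraph) (P Q : VSet D) → e D P Q ≡ sum² (λ i j → b2n (P i ∧ Q j ∧ arc D i j))
  e≡sum² D P Q = trans (ℕΣ.Σ[]≡sum (λ i → Σ[ row i ])) (ℕΣ.sum-cong-≗ (λ i → ℕΣ.Σ[]≡sum (row i)))
    where
    row : Fin (n D) → Fin (n D) → ℕ
    row i j = b2n (P i ∧ Q j ∧ arc D i j)

  e-cong : (D : Digraph) {P P′ Q Q′ : VSet D} →
           (∀ i → P i ≡ P′ i) → (∀ j → Q j ≡ Q′ j) → e D P Q ≡ e D P′ Q′
  e-cong D {P} {P′} {Q} {Q′} P≗P′ Q≗Q′ = trans (e≡sum² D P Q) (trans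
    (sum²-cong (λ i j → cong₂ (λ p q → b2n (p ∧ q ∧ arc D i j)) (P≗P′ i) (Q≗Q′ j)))
    (sym (e≡sum² D P′ Q′)))

  Independent : (D : Digraph) → VSet D → Set
  Independent D X = ∀ i j → X i ≡ true → X j ≡ true → arc D i j ≡ false

  e≡0⇒independent : (D : Digraph) (X : VSet D) → e D X X ≡ 0 → Independent D X
  e≡0⇒independent D X eXX≡0 i j Xi Xj = b2n≡0 (arc D i j) (begin
    b2n (arc D i j)                 ≡⟨ cong₂ (λ p q → b2n (p ∧ q ∧ arc D i j)) Xi Xj ⟨
    b2n (X i ∧ X j ∧ arc D i j)     ≡⟨ ℕΣ.sum≡0⇒≡0 _ (ℕΣ.sum≡0⇒≡0 _ (trans (sym (e≡sum² D X X)) eXX≡0) i) j ⟩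
    0                               ∎)
    where
    open ≡-Reasoning
    b2n≡0 : ∀ b → b2n b ≡ 0 → b ≡ false
    b2n≡0 false _ = refl

  deg≡ : (D : Digraph) (y : Fin (n D)) →
         deg D y ≡ ℕΣ.sum (λ j → b2n (arc D y j)) + ℕΣ.sum (λ i → b2n (arc D i y))
  deg≡ D y = cong₂ _+_ (ℕΣ.Σ[]≡sum (λ j → b2n (arc D y j))) (ℕΣ.Σ[]≡sum (λ i → b2n (arc D i y)))

  handshake : (D : Digraph) → ℕΣ.sum (deg D) ≡ 2 * arcs D
  handshake D = begin
    ℕΣ.sum (deg D)                              ≡⟨ ℕΣ.sum-cong-≗ (deg≡ D) ⟩
    ℕΣ.sum (λ y → ℕΣ.sum (a y) + ℕΣ.sum (λ i → a i y)) ≡⟨ ℕΣ.∑-distrib-+ (ℕΣ.sum ∘ a) (λ y → ℕΣ.sum (λ i → a i y)) ⟩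
    sum² a + ℕΣ.sum (λ y → ℕΣ.sum (λ i → a i y)) ≡⟨ cong (λ t → sum² a + t) (ℕΣ.∑-comm a) ⟨
    sum² a + sum² a                             ≡⟨ cong (λ t → t + t) (e≡sum² D (full D) (full D)) ⟨
    arcs D + arcs D                             ≡⟨ cong (λ t → arcs D + t) (NP.+-identityʳ (arcs D)) ⟨
    2 * arcs D                                  ∎
    where
    open ≡-Reasoning
    a : Fin (n D) → Fin (n D) → ℕ
    a i j = b2n (arc D i j)

module _ where
  open Nat using (_+_; _*_; _≤_; _<_)
  open import Data.Nat.Tactic.RingSolver using (solve-∀)

  does-<?-suc : ∀ {m k} → m ≢ k → does (m Nat.<? suc k) ≡ does (m Nat.<? k)
  does-<?-suc {m} {k} m≢k = by-cases (m Nat.<? k)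
    where
    by-cases : Dec (m < k) → does (m Nat.<? suc k) ≡ does (m Nat.<? k)
    by-cases (yes m<k) = trans (dec-true (m Nat.<? suc k) (NP.m<n⇒m<1+n m<k)) (sym (dec-true (m Nat.<? k) m<k))
    by-cases (no  m≮k) = trans (dec-false (m Nat.<? suc k) (λ m<1+k → m≮k (NP.≤∧≢⇒< (Nat.s≤s⁻¹ m<1+k) m≢k)))
                               (sym (dec-false (m Nat.<? k) m≮k))

  first-factor-≤ : ∀ {p q x t} → p ≤ 2 → q ≤ 2 → x ≤ t → p * q * x ≤ 1 * q * x + 2 * t
  first-factor-≤ {p} {q} {x} {t} p≤2 q≤2 x≤t = begin
    p * q * x          ≤⟨ NP.*-monoˡ-≤ x (NP.*-monoˡ-≤ q p≤2) ⟩
    2 * q * x          ≡⟨ split q x ⟩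
    1 * q * x + q * x  ≤⟨ NP.+-monoʳ-≤ (1 * q * x) (NP.*-mono-≤ q≤2 x≤t) ⟩
    1 * q * x + 2 * t  ∎
    where
    open NP.≤-Reasoning
    split : ∀ q x → 2 * q * x ≡ 1 * q * x + q * x
    split = solve-∀

  second-factor-≤ : ∀ {p q x t} → p ≤ 2 → q ≤ 2 → x ≤ t → p * q * x ≤ p * 1 * x + 2 * t
  second-factor-≤ {p} {q} {x} {t} p≤2 q≤2 x≤t = begin
    p * q * x          ≤⟨ NP.*-monoˡ-≤ x (NP.*-monoʳ-≤ p q≤2) ⟩
    p * 2 * x          ≡⟨ split p x ⟩
    p * 1 * x + p * x  ≤⟨ NP.+-monoʳ-≤ (p * 1 * x) (NP.*-mono-≤ p≤2 x≤t) ⟩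
    p * 1 * x + 2 * t  ∎
    where
    open NP.≤-Reasoning
    split : ∀ p x → p * 2 * x ≡ p * 1 * x + p * x
    split = solve-∀

  average-first : ∀ q x → 2 * 1 * q * x + 2 * 0 * q * x ≡ 2 * (1 * q * x)
  average-first = solve-∀

  average-second : ∀ p x → p * (2 * 0) * x + p * (2 * 1) * x ≡ 2 * (p * 1 * x)
  average-second = solve-∀

  double : ∀ t → t + t ≡ 2 * t
  double = solve-∀

  -- twice the probability that a vertex is on side b, given whether it is placed yet
  weight : Bool → Bool → ℕ
  weight p b = if p then 2 * b2n b else 1

  weight≤2 : ∀ p b → weight p b ≤ 2
  weight≤2 true  true  = NP.≤-refl
  weight≤2 true  false = z≤n
  weight≤2 false b     = s≤s z≤n

  weight-complete : ∀ v u x → weight true v * weight true (not u) * b2n x ≡ 4 * b2n (v ∧ not u ∧ x)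
  weight-complete true  true  x = refl
  weight-complete true  false x = refl
  weight-complete false u     x = refl

  weight-initial : ∀ xi vi xj vj x → (xi ≡ true → xj ≡ true → x ≡ false) →
    weight xi vi * weight xj (not vj) * b2n x
      + (b2n ((xi ∧ not vi) ∧ not xj ∧ x) + b2n (not xi ∧ (xj ∧ vj) ∧ x))
    ≡ b2n (true ∧ true ∧ x) + (b2n ((xi ∧ vi) ∧ not xj ∧ x) + b2n (not xi ∧ (xj ∧ not vj) ∧ x))
  weight-initial true  _     true  _     true  indep with () ← indep refl refl
  weight-initial true  true  true  true  false _ = refl
  weight-initial true  true  true  false false _ = refl
  weight-initial true  false true  true  false _ = refl
  weight-initial true  false true  false false _ = refl
  weight-initial true  true  false _     true  _ = refl
  weight-initial true  true  false _     false _ = refl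
  weight-initial true  false false _     true  _ = refl
  weight-initial true  false false _     false _ = refl
  weight-initial false _     true  true  true  _ = refl
  weight-initial false _     true  true  false _ = refl
  weight-initial false _     true  false true  _ = refl
  weight-initial false _     true  false false _ = refl
  weight-initial false _     false _     true  _ = refl
  weight-initial false _     false _     false _ = refl

module _ where
  open Int using (_+_; _-_)
  open import Data.Integer.Tactic.RingSolver using (solve-∀)

  pos-balance : ∀ {p m a b c d} → p Nat.+ (c Nat.+ d) ≡ m Nat.+ (a Nat.+ b) →
                + p ≡ + m + ((+ a + + b) - (+ c + + d))
  pos-balance {p} {m} {a} {b} {c} {d} balance = begin
    + p                                      ≡⟨ solve₁ (+ p) (+ c + + d) ⟩
    (+ p + (+ c + + d)) - (+ c + + d)        ≡⟨ cong (_- (+ c + + d)) cast ⟩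
    (+ m + (+ a + + b)) - (+ c + + d)        ≡⟨ solve₂ (+ m) (+ a + + b) (+ c + + d) ⟩
    + m + ((+ a + + b) - (+ c + + d))        ∎
    where
    open ≡-Reasoning
    cast : + p + (+ c + + d) ≡ + m + (+ a + + b)
    cast =
      trans (cong (λ t → + p + t) (sym (ZP.pos-+ c d))) (trans (sym (ZP.pos-+ p _)) (trans (cong +_ balance)
        (trans (ZP.pos-+ m _) (cong (λ t → + m + t) (ZP.pos-+ a b)))))
    solve₁ : ∀ p s → p ≡ (p + s) - s
    solve₁ = solve-∀
    solve₂ : ∀ m s t → (m + s) - t ≡ m + (s - t)
    solve₂ = solve-∀

  flip-gap : ∀ m g h → m + (h - g) ≡ m - (g - h)
  flip-gap = solve-∀

-- Vertices of X are placed from the start, those of Y = V(D) ∖ X one at a time in index order.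
-- Φ k V is four times the expected number of arcs from V to its complement when each unplaced
-- vertex chooses its side independently and uniformly; V is only consulted on placed vertices.
module ExpectedCut (D : Digraph) (X : VSet D) where
  open Nat using (_+_; _*_; _≤_; _<_)

  private
    N : ℕ
    N = n D

  a : Fin N → Fin N → ℕ
  a i j = b2n (arc D i j)

  placed : ℕ → Fin N → Bool
  placed k y = X y ∨ does (toℕ y Nat.<? k)

  w : ℕ → (Fin N → Bool) → Fin N → ℕ
  w k V y = weight (placed k y) (V y)

  term : ℕ → (Fin N → Bool) → Fin N → Fin N → ℕ
  term k V i j = w k V i * w k (not ∘ V) j * a i j

  Φ : ℕ → (Fin N → Bool) → ℕ
  Φ k V = sum² (term k V)

  placed-initial : ∀ y → placed 0 y ≡ X y
  placed-initial y = trans (cong (λ b → X y ∨ b) (dec-false (toℕ y Nat.<? 0) λ ())) (BP.∨-identityʳ (X y))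

  placed-all : ∀ y → placed N y ≡ true
  placed-all y = trans (cong (λ b → X y ∨ b) (dec-true (toℕ y Nat.<? N) (FP.toℕ<n y))) (BP.∨-zeroʳ (X y))

  Φ-complete : ∀ V → Φ N V ≡ 4 * e D V (compl {D} V)
  Φ-complete V = begin
    Φ N V                                   ≡⟨ sum²-cong cell ⟩
    sum² (λ i j → 4 * cut i j)              ≡⟨ *-distribˡ-sum² 4 cut ⟨
    4 * sum² cut                            ≡⟨ cong (4 *_) (e≡sum² D V (compl {D} V)) ⟨
    4 * e D V (compl {D} V)                 ∎
    where
    open ≡-Reasoning
    cut : Fin N → Fin N → ℕ
    cut i j = b2n (V i ∧ not (V j) ∧ arc D i j)
    cell : ∀ i j → term N V i j ≡ 4 * cut i j
    cell i j = trans (cong₂ (λ p q → weight p (V i) * weight q (not (V j)) * a i j) (placed-all i) (placed-all j))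
                     (weight-complete (V i) (V j) (arc D i j))

  -- V splits X into X ∧ V and X ∧ ¬V; an arc between X and Y counts 2 or 0 in Φ 0 V, one inside Y counts 1.
  Φ-initial : Independent D X → ∀ V →
    let Y   = compl {D} X
        In  = λ i → X i ∧ V i
        Out = λ i → X i ∧ not (V i)
    in Φ 0 V + (e D Out Y + e D Y In) ≡ arcs D + (e D In Y + e D Y Out)
  Φ-initial indep V = begin
    Φ 0 V + (e D Out Y + e D Y In)
      ≡⟨ cong₂ (λ s t → Φ 0 V + (s + t)) (e≡sum² D Out Y) (e≡sum² D Y In) ⟩
    sum² (term 0 V) + (sum² (cross Out Y) + sum² (cross Y In))
      ≡⟨ sum²-distrib-+₃ (term 0 V) (cross Out Y) (cross Y In) ⟨
    sum² (λ i j → term 0 V i j + (cross Out Y i j + cross Y In i j))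
      ≡⟨ sum²-cong cell ⟩
    sum² (λ i j → cross (full D) (full D) i j + (cross In Y i j + cross Y Out i j))
      ≡⟨ sum²-distrib-+₃ (cross (full D) (full D)) (cross In Y) (cross Y Out) ⟩
    sum² (cross (full D) (full D)) + (sum² (cross In Y) + sum² (cross Y Out))
      ≡⟨ cong₂ _+_ (e≡sum² D (full D) (full D)) (cong₂ _+_ (e≡sum² D In Y) (e≡sum² D Y Out)) ⟨
    arcs D + (e D In Y + e D Y Out)
      ∎
    where
    open ≡-Reasoning
    Y In Out : VSet D
    Y   = compl {D} X
    In  = λ i → X i ∧ V i
    Out = λ i → X i ∧ not (V i)
    cross : VSet D → VSet D → Fin N → Fin N → ℕ
    cross P Q i j = b2n (P i ∧ Q j ∧ arc D i j)
    cell : ∀ i j → term 0 V i j + (cross Out Y i j + cross Y In i j)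
                 ≡ cross (full D) (full D) i j + (cross In Y i j + cross Y Out i j)
    cell i j = trans (cong₂ (λ p q → weight p (V i) * weight q (not (V j)) * a i j + (cross Out Y i j + cross Y In i j))
                            (placed-initial i) (placed-initial j))
                     (weight-initial (X i) (V i) (X j) (V j) (arc D i j) (indep i j))

  module _ (indep : Independent D X) {X₁ : VSet D} (X₁⊆X : _⊆_ {D} X₁ X) where
    private
      Y X₂ : VSet D
      Y  = compl {D} X
      X₂ = _∖_ {D} X X₁
      m : ℕ
      m = arcs D
      meet : ∀ i → X i ∧ X₁ i ≡ X₁ i
      meet i with X₁ i in X₁i
      ... | true  = cong (_∧ true) (X₁⊆X i X₁i)
      ... | false = BP.∧-zeroʳ (X i)
      double-not : ∀ i → X i ∧ not (not (X₁ i)) ≡ X₁ i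
      double-not i = trans (cong (X i ∧_) (BP.not-involutive (X₁ i))) (meet i)

    Φ-initial-gap : + Φ 0 X₁ ≡ + m Int.+ gap D X X₁
    Φ-initial-gap = pos-balance {Φ 0 X₁} {m} {e D X₁ Y} {e D Y X₂} {e D X₂ Y} {e D Y X₁}
      (trans (cong (λ t → Φ 0 X₁ + (e D X₂ Y + t)) (sym (e-cong D {Y} {Y} (λ _ → refl) meet)))
             (trans (Φ-initial indep X₁) (cong (λ t → m + (t + e D Y X₂)) (e-cong D {Q = Y} {Y} meet (λ _ → refl)))))

    Φ-initial-gap-reversed : + Φ 0 (not ∘ X₁) ≡ + m Int.- gap D X X₁
    Φ-initial-gap-reversed = trans
      (pos-balance {Φ 0 (not ∘ X₁)} {m} {e D X₂ Y} {e D Y X₁} {e D X₁ Y} {e D Y X₂}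
        (trans (cong (λ t → Φ 0 (not ∘ X₁) + (t + e D Y X₂)) (sym (e-cong D {Q = Y} {Y} double-not (λ _ → refl))))
               (trans (Φ-initial indep (not ∘ X₁)) (cong (λ t → m + (e D X₂ Y + t)) (e-cong D {Y} {Y} (λ _ → refl) double-not)))))
      (flip-gap (+ m) (+ e D X₁ Y Int.+ + e D Y X₂) (+ e D X₂ Y Int.+ + e D Y X₁))

  Agree : Fin N → (Fin N → Bool) → (Fin N → Bool) → Set
  Agree y V W = ∀ i → i ≢ y → W i ≡ V i

  term-loop : ∀ k V y → term k V y y ≡ 0
  term-loop k V y = trans (cong (λ b → w k V y * w k (not ∘ V) y * b2n b) (loopless D y)) (NP.*-zeroʳ (w k V y * w k (not ∘ V) y))

  around : Fin N → Fin N → Fin N → ℕ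
  around y i j = (if does (i ≟ y) then a i j else 0) + (if does (j ≟ y) then a i j else 0)

  sum²-around : ∀ y → sum² (around y) ≡ deg D y
  sum²-around y = begin
    sum² (around y)
      ≡⟨ sum²-distrib-+ (λ i j → if does (i ≟ y) then a i j else 0) (λ i j → if does (j ≟ y) then a i j else 0) ⟩
    ℕΣ.sum (λ i → ℕΣ.sum (λ j → if does (i ≟ y) then a i j else 0)) + ℕΣ.sum (λ i → ℕΣ.sum (λ j → if does (j ≟ y) then a i j else 0))
      ≡⟨ cong₂ _+_ (trans (ℕΣ.sum-cong-≗ (λ i → ℕΣ.sum-if (does (i ≟ y)) (a i))) (ℕΣ.sum-indicator y (ℕΣ.sum ∘ a)))
                   (ℕΣ.sum-cong-≗ (λ i → ℕΣ.sum-indicator y (a i))) ⟩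
    ℕΣ.sum (a y) + ℕΣ.sum (λ i → a i y)
      ≡⟨ deg≡ D y ⟨
    deg D y ∎
    where open ≡-Reasoning

  module _ {k : ℕ} {y : Fin N} (y≡k : toℕ y ≡ k) where

    placed-next : placed (suc k) y ≡ true
    placed-next = trans (cong (λ b → X y ∨ b) (dec-true (toℕ y Nat.<? suc k) (subst (λ t → toℕ y < suc t) y≡k (NP.n<1+n _))))
                        (BP.∨-zeroʳ (X y))

    placed-now : X y ≡ false → placed k y ≡ false
    placed-now Xy = cong₂ _∨_ Xy (dec-false (toℕ y Nat.<? k) (NP.<-irrefl y≡k))

    placed-other : ∀ {i} → i ≢ y → placed (suc k) i ≡ placed k i
    placed-other {i} i≢y = cong (λ b → X i ∨ b) (does-<?-suc (λ i≡k → i≢y (FP.toℕ-injective (trans i≡k (sym y≡k)))))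

    w-next : ∀ V → w (suc k) V y ≡ 2 * b2n (V y)
    w-next V = cong (λ p → weight p (V y)) placed-next

    w-now : X y ≡ false → ∀ V → w k V y ≡ 1
    w-now Xy V = cong (λ p → weight p (V y)) (placed-now Xy)

    w-other : ∀ {i} V W → i ≢ y → W i ≡ V i → w (suc k) W i ≡ w k V i
    w-other V W i≢y Wi≡Vi = cong₂ weight (placed-other i≢y) Wi≡Vi

    term-row : ∀ {V W j b} → Agree y V W → j ≢ y → W y ≡ b →
               term (suc k) W y j ≡ 2 * b2n b * w k (not ∘ V) j * a y j
    term-row {V} {W} {j} W≈V j≢y Wy≡b =
      cong₂ (λ p q → p * q * a y j) (trans (w-next W) (cong (λ c → 2 * b2n c) Wy≡b))
                                     (w-other (not ∘ V) (not ∘ W) j≢y (cong not (W≈V j j≢y)))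

    term-col : ∀ {V W i b} → Agree y V W → i ≢ y → W y ≡ b →
               term (suc k) W i y ≡ w k V i * (2 * b2n (not b)) * a i y
    term-col {V} {W} {i} W≈V i≢y Wy≡b =
      cong₂ (λ p q → p * q * a i y) (w-other V W i≢y (W≈V i i≢y))
                                     (trans (w-next (not ∘ W)) (cong (λ c → 2 * b2n (not c)) Wy≡b))

    term-off : ∀ {V W i j} → Agree y V W → i ≢ y → j ≢ y → term (suc k) W i j ≡ term k V i j
    term-off {V} {W} {i} {j} W≈V i≢y j≢y =
      cong₂ (λ p q → p * q * a i j) (w-other V W i≢y (W≈V i i≢y))
                                     (w-other (not ∘ V) (not ∘ W) j≢y (cong not (W≈V j j≢y)))

    term-row-now : X y ≡ false → ∀ V j → term k V y j ≡ 1 * w k (not ∘ V) j * a y j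
    term-row-now Xy V j = cong (λ p → p * w k (not ∘ V) j * a y j) (w-now Xy V)

    term-col-now : X y ≡ false → ∀ V i → term k V i y ≡ w k V i * 1 * a i y
    term-col-now Xy V i = cong (λ q → w k V i * q * a i y) (w-now Xy (not ∘ V))

    term-average : X y ≡ false → ∀ {V V₁ V₀} → Agree y V V₁ → Agree y V V₀ → V₁ y ≡ true → V₀ y ≡ false →
                   ∀ i j → term (suc k) V₁ i j + term (suc k) V₀ i j ≡ 2 * term k V i j
    term-average Xy {V} {V₁} {V₀} V₁≈V V₀≈V V₁y V₀y i j with i ≟ y | j ≟ y
    ... | yes refl | yes refl =
      trans (cong₂ _+_ (term-loop (suc k) V₁ y) (term-loop (suc k) V₀ y)) (sym (cong (2 *_) (term-loop k V y)))
    ... | yes refl | no j≢y = begin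
      term (suc k) V₁ y j + term (suc k) V₀ y j  ≡⟨ cong₂ _+_ (term-row V₁≈V j≢y V₁y) (term-row V₀≈V j≢y V₀y) ⟩
      2 * 1 * q * a y j + 2 * 0 * q * a y j      ≡⟨ average-first q (a y j) ⟩
      2 * (1 * q * a y j)                        ≡⟨ cong (2 *_) (term-row-now Xy V j) ⟨
      2 * term k V y j                           ∎
      where
      open ≡-Reasoning
      q : ℕ
      q = w k (not ∘ V) j
    ... | no i≢y | yes refl = begin
      term (suc k) V₁ i y + term (suc k) V₀ i y  ≡⟨ cong₂ _+_ (term-col V₁≈V i≢y V₁y) (term-col V₀≈V i≢y V₀y) ⟩
      p * (2 * 0) * a i y + p * (2 * 1) * a i y  ≡⟨ average-second p (a i y) ⟩
      2 * (p * 1 * a i y)                        ≡⟨ cong (2 *_) (term-col-now Xy V i) ⟨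
      2 * term k V i y                           ∎
      where
      open ≡-Reasoning
      p : ℕ
      p = w k V i
    ... | no i≢y | no j≢y =
      trans (cong₂ _+_ (term-off V₁≈V i≢y j≢y) (term-off V₀≈V i≢y j≢y)) (double (term k V i j))

    term-step-≤ : X y ≡ false → ∀ {V W} → Agree y V W → ∀ i j → term (suc k) W i j ≤ term k V i j + 2 * around y i j
    term-step-≤ Xy {V} {W} W≈V i j = by-cases i j (i ≟ y) (j ≟ y)
     where
     by-cases : ∀ i j → Dec (i ≡ y) → Dec (j ≡ y) → term (suc k) W i j ≤ term k V i j + 2 * around y i j
     by-cases i j (yes refl) (yes refl) = subst (_≤ term k V y y + 2 * around y y y) (sym (term-loop (suc k) W y)) z≤n
     by-cases i j (yes refl) (no j≢y) = begin
      term (suc k) W y j                 ≡⟨ term-row W≈V j≢y refl ⟩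
      2 * b2n (W y) * q * a y j          ≤⟨ first-factor-≤ (weight≤2 true (W y)) (weight≤2 (placed k j) (not (V j))) a≤around ⟩
      1 * q * a y j + 2 * around y y j   ≡⟨ cong (λ t → t + 2 * around y y j) (term-row-now Xy V j) ⟨
      term k V y j + 2 * around y y j    ∎
      where
      open NP.≤-Reasoning
      q : ℕ
      q = w k (not ∘ V) j
      a≤around : a y j ≤ around y y j
      a≤around = subst (λ b → a y j ≤ (if b then a y j else 0) + (if does (j ≟ y) then a y j else 0))
                       (sym (dec-true (y ≟ y) refl)) (NP.m≤m+n (a y j) _)
     by-cases i j (no i≢y) (yes refl) = begin
      term (suc k) W i y                    ≡⟨ term-col W≈V i≢y refl ⟩
      p * (2 * b2n (not (W y))) * a i y     ≤⟨ second-factor-≤ (weight≤2 (placed k i) (V i)) (weight≤2 true (not (W y))) a≤around ⟩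
      p * 1 * a i y + 2 * around y i y      ≡⟨ cong (λ t → t + 2 * around y i y) (term-col-now Xy V i) ⟨
      term k V i y + 2 * around y i y       ∎
      where
      open NP.≤-Reasoning
      p : ℕ
      p = w k V i
      a≤around : a i y ≤ around y i y
      a≤around = subst (λ b → a i y ≤ (if does (i ≟ y) then a i y else 0) + (if b then a i y else 0))
                       (sym (dec-true (y ≟ y) refl)) (NP.m≤n+m (a i y) _)
     by-cases i j (no i≢y) (no j≢y) =
       subst (_≤ term k V i j + 2 * around y i j) (sym (term-off W≈V i≢y j≢y)) (NP.m≤m+n _ _)

    Φ-average : X y ≡ false → ∀ {V V₁ V₀} → Agree y V V₁ → Agree y V V₀ → V₁ y ≡ true → V₀ y ≡ false →
                Φ (suc k) V₁ + Φ (suc k) V₀ ≡ 2 * Φ k V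
    Φ-average Xy {V} {V₁} {V₀} V₁≈V V₀≈V V₁y V₀y = begin
      Φ (suc k) V₁ + Φ (suc k) V₀                            ≡⟨ sum²-distrib-+ (term (suc k) V₁) (term (suc k) V₀) ⟨
      sum² (λ i j → term (suc k) V₁ i j + term (suc k) V₀ i j) ≡⟨ sum²-cong (term-average Xy V₁≈V V₀≈V V₁y V₀y) ⟩
      sum² (λ i j → 2 * term k V i j)                        ≡⟨ *-distribˡ-sum² 2 (term k V) ⟨
      2 * Φ k V                                              ∎
      where open ≡-Reasoning

    Φ-step-≤ : X y ≡ false → ∀ {V W} → Agree y V W → Φ (suc k) W ≤ Φ k V + 2 * deg D y
    Φ-step-≤ Xy {V} {W} W≈V = begin
      Φ (suc k) W                                ≤⟨ sum²-mono-≤ (term-step-≤ Xy W≈V) ⟩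
      sum² (λ i j → term k V i j + 2 * around y i j) ≡⟨ sum²-distrib-+ (term k V) (λ i j → 2 * around y i j) ⟩
      Φ k V + sum² (λ i j → 2 * around y i j)    ≡⟨ cong (λ t → Φ k V + t) (*-distribˡ-sum² 2 (around y)) ⟨
      Φ k V + 2 * sum² (around y)                ≡⟨ cong (λ t → Φ k V + 2 * t) (sum²-around y) ⟩
      Φ k V + 2 * deg D y                        ∎
      where open NP.≤-Reasoning

    Φ-stay : X y ≡ true → ∀ V → Φ (suc k) V ≡ Φ k V
    Φ-stay Xy V = sum²-cong (λ i j → cong₂ (λ p q → weight p (V i) * weight q (not (V j)) * a i j)
                                            (same-placement i) (same-placement j))
      where
      same-placement : ∀ i → placed (suc k) i ≡ placed k i
      same-placement i with i ≟ y
      ... | yes refl = trans (cong (λ b → b ∨ _) Xy) (sym (cong (λ b → b ∨ _) Xy))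
      ... | no i≢y  = placed-other i≢y

module _ where
  open Int using (_+_; _-_; _*_; _≤_)
  open import Data.Integer.Tactic.RingSolver using (solve-∀)

  sq : ℤ → ℤ
  sq z = z * z

  sq-≤ : ∀ {u} c → - + c ≤ u → u ≤ + c → sq u ≤ + (c Nat.* c)
  sq-≤ {+ m}      c _   m≤c   = subst (_≤ + (c Nat.* c)) (ZP.pos-* m m)
                                  (Int.+≤+ (NP.*-mono-≤ (ZP.drop‿+≤+ m≤c) (ZP.drop‿+≤+ m≤c)))
  sq-≤ {Int.-[1+ m ]} c -c≤u _ = subst (_≤ + (c Nat.* c)) (ZP.pos-* (suc m) (suc m))
                                  (Int.+≤+ (NP.*-mono-≤ m<c m<c))
    where
    m<c : suc m Nat.≤ c
    m<c = ZP.drop‿+≤+ (ZP.neg-cancel-≤ -c≤u)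

  private
    expand-+ : ∀ a b u v → (a + u) * (a + u) + (b + v) * (b + v)
                         ≡ a * a + b * b + (u * u + v * v) + + 2 * (a * u + b * v)
    expand-+ = solve-∀
    expand-- : ∀ a b u v → (a - u) * (a - u) + (b - v) * (b - v)
                         ≡ a * a + b * b + (u * u + v * v) + + 2 * - (a * u + b * v)
    expand-- = solve-∀
    plus-twice-≤0 : ∀ K {t} → t ≤ + 0 → K + + 2 * t ≤ K
    plus-twice-≤0 K {t} t≤0 = ZP.≤-trans (ZP.+-monoʳ-≤ K (ZP.*-monoˡ-≤-nonNeg (+ 2) t≤0))
                                          (ZP.≤-reflexive (trans (cong (λ t → K + t) (ZP.*-zeroʳ (+ 2))) (ZP.+-identityʳ K)))

  sq-nonneg : ∀ z → + 0 ≤ sq z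
  sq-nonneg (+ m)          = subst (+ 0 ≤_) (ZP.pos-* m m) (Int.+≤+ z≤n)
  sq-nonneg Int.-[1+ m ]   = subst (+ 0 ≤_) (ZP.pos-* (suc m) (suc m)) (Int.+≤+ z≤n)

  -- the cross terms ±2(au + bv) of the two moves have opposite signs
  square-choice : ∀ a b u v →
    (sq (a + u) + sq (b + v) ≤ sq a + sq b + (sq u + sq v)) ⊎
    (sq (a - u) + sq (b - v) ≤ sq a + sq b + (sq u + sq v))
  square-choice a b u v with (a * u + b * v) ZP.≤? + 0
  ... | yes cross≤0 = inj₁ (subst (_≤ base) (sym (expand-+ a b u v)) (plus-twice-≤0 base cross≤0))
    where
    base : ℤ
    base = sq a + sq b + (sq u + sq v)
  ... | no  cross≰0 = inj₂ (subst (_≤ base) (sym (expand-- a b u v))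
                                  (plus-twice-≤0 base (ZP.neg-mono-≤ (ZP.<⇒≤ (ZP.≰⇒> cross≰0)))))
    where
    base : ℤ
    base = sq a + sq b + (sq u + sq v)

  private
    pos-avg : ∀ {x x₁ x₀} → x₁ Nat.+ x₀ ≡ 2 Nat.* x → + x₁ + + x₀ ≡ + 2 * + x
    pos-avg {x} {x₁} {x₀} avg = trans (sym (ZP.pos-+ x₁ x₀)) (trans (cong +_ avg) (ZP.pos-* 2 x))

    move-up : ∀ x x₁ P → x₁ - P ≡ (x - P) + (x₁ - x)
    move-up = solve-∀

    move-down : ∀ x x₁ x₀ P → x₁ + x₀ ≡ + 2 * x → x₀ - P ≡ (x - P) - (x₁ - x)
    move-down x x₁ x₀ P avg = begin
      x₀ - P                   ≡⟨ solve₁ x₁ x₀ P ⟩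
      (x₁ + x₀) - x₁ - P       ≡⟨ cong (λ t → t - x₁ - P) avg ⟩
      + 2 * x - x₁ - P         ≡⟨ solve₂ x x₁ P ⟩
      (x - P) - (x₁ - x)       ∎
      where
      open ≡-Reasoning
      solve₁ : ∀ x₁ x₀ P → x₀ - P ≡ (x₁ + x₀) - x₁ - P
      solve₁ = solve-∀
      solve₂ : ∀ x x₁ P → + 2 * x - x₁ - P ≡ (x - P) - (x₁ - x)
      solve₂ = solve-∀

    diff-≤ : ∀ {a b c} → a Nat.≤ b Nat.+ c → + a - + b ≤ + c
    diff-≤ {a} {b} {c} a≤b+c = begin
      + a - + b          ≤⟨ ZP.+-monoˡ-≤ (- + b) (Int.+≤+ a≤b+c) ⟩
      + (b Nat.+ c) - + b ≡⟨ cong (_- + b) (ZP.pos-+ b c) ⟩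
      + b + + c - + b    ≡⟨ cancel (+ b) (+ c) ⟩
      + c                ∎
      where
      open ZP.≤-Reasoning
      cancel : ∀ b c → b + c - b ≡ c
      cancel = solve-∀

    zero-minus : ∀ x u → (x - x) - u ≡ - u
    zero-minus = solve-∀

    bounded-move : ∀ {x x₁ x₀} c → x₁ Nat.+ x₀ ≡ 2 Nat.* x → x₁ Nat.≤ x Nat.+ c → x₀ Nat.≤ x Nat.+ c →
                   sq (+ x₁ - + x) ≤ + (c Nat.* c)
    bounded-move {x} {x₁} {x₀} c avg x₁≤ x₀≤ = sq-≤ c lower (diff-≤ x₁≤)
      where
      -u≤c : - (+ x₁ - + x) ≤ + c
      -u≤c = subst (_≤ + c) (trans (move-down (+ x) (+ x₁) (+ x₀) (+ x) (pos-avg {x} {x₁} {x₀} avg)) (zero-minus (+ x) _)) (diff-≤ x₀≤)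
      lower : - + c ≤ + x₁ - + x
      lower = subst (- + c ≤_) (ZP.neg-involutive _) (ZP.neg-mono-≤ -u≤c)

  balanced-choice : ∀ {x x₁ x₀ y y₁ y₀} c (P R : ℤ) →
    x₁ Nat.+ x₀ ≡ 2 Nat.* x → y₁ Nat.+ y₀ ≡ 2 Nat.* y →
    x₁ Nat.≤ x Nat.+ c → x₀ Nat.≤ x Nat.+ c → y₁ Nat.≤ y Nat.+ c → y₀ Nat.≤ y Nat.+ c →
    (sq (+ x₁ - P) + sq (+ y₁ - R) ≤ sq (+ x - P) + sq (+ y - R) + + (2 Nat.* (c Nat.* c))) ⊎
    (sq (+ x₀ - P) + sq (+ y₀ - R) ≤ sq (+ x - P) + sq (+ y - R) + + (2 Nat.* (c Nat.* c)))
  balanced-choice {x} {x₁} {x₀} {y} {y₁} {y₀} c P R x-avg y-avg x₁≤ x₀≤ y₁≤ y₀≤ =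
    choose (square-choice A B u v)
    where
    A B u v : ℤ
    A = + x - P
    B = + y - R
    u = + x₁ - + x
    v = + y₁ - + y
    budget : sq A + sq B + (sq u + sq v) ≤ sq A + sq B + + (2 Nat.* (c Nat.* c))
    budget = ZP.+-monoʳ-≤ (sq A + sq B)
               (ZP.≤-trans (ZP.+-mono-≤ (bounded-move {x} c x-avg x₁≤ x₀≤) (bounded-move {y} c y-avg y₁≤ y₀≤))
                           (ZP.≤-reflexive (trans (sym (ZP.pos-+ (c Nat.* c) (c Nat.* c))) (cong +_ (double (c Nat.* c))))))
    choose : _ → _
    choose (inj₁ closer) = inj₁ (subst₂ (λ s t → sq s + sq t ≤ _)
                                        (sym (move-up (+ x) (+ x₁) P)) (sym (move-up (+ y) (+ y₁) R))
                                        (ZP.≤-trans closer budget))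
    choose (inj₂ closer) = inj₂ (subst₂ (λ s t → sq s + sq t ≤ _)
                                        (sym (move-down (+ x) (+ x₁) (+ x₀) P (pos-avg {x} {x₁} {x₀} x-avg)))
                                        (sym (move-down (+ y) (+ y₁) (+ y₀) R (pos-avg {y} {y₁} {y₀} y-avg)))
                                        (ZP.≤-trans closer budget))

module GreedyPlacement (D : Digraph) (X : VSet D) (V₀ : Fin (n D) → Bool) where
  open ExpectedCut D X
  open Int using (_+_; _-_; _≤_)

  deviation : ℕ → (Fin (n D) → Bool) → ℤ
  deviation k V = sq (+ Φ k V - + Φ 0 V₀) + sq (+ Φ k (not ∘ V) - + Φ 0 (not ∘ V₀))

  budget : ℕ → ℕ
  budget k = ℕΣ.sum (λ y → if does (toℕ y Nat.<? k) ∧ not (X y) then deg D y Nat.* deg D y else 0)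

  budget-step : ∀ {k y} → toℕ y ≡ k →
                budget (suc k) ≡ budget k Nat.+ (if not (X y) then deg D y Nat.* deg D y else 0)
  budget-step {k} {y} y≡k = begin
    budget (suc k)                                           ≡⟨ ℕΣ.sum-cong-≗ (λ i → cell i (i ≟ y)) ⟩
    ℕΣ.sum (λ i → f k i Nat.+ indicator i)                   ≡⟨ ℕΣ.∑-distrib-+ (f k) indicator ⟩
    budget k Nat.+ ℕΣ.sum indicator                          ≡⟨ cong (λ t → budget k Nat.+ t) (ℕΣ.sum-indicator y g) ⟩
    budget k Nat.+ g y                                       ∎
    where
    open ≡-Reasoning
    f : ℕ → Fin (n D) → ℕ
    f k i = if does (toℕ i Nat.<? k) ∧ not (X i) then deg D i Nat.* deg D i else 0
    g indicator : Fin (n D) → ℕ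
    g i = if not (X i) then deg D i Nat.* deg D i else 0
    indicator i = if does (i ≟ y) then g i else 0
    cell : ∀ i → Dec (i ≡ y) → f (suc k) i ≡ f k i Nat.+ indicator i
    cell i (yes refl) =
      trans (cong (λ b → if b ∧ not (X y) then deg D y Nat.* deg D y else 0)
                  (dec-true (toℕ y Nat.<? suc k) (subst (λ t → toℕ y Nat.< suc t) y≡k (NP.n<1+n _))))
            (sym (cong₂ (λ b c → (if b ∧ not (X y) then deg D y Nat.* deg D y else 0) Nat.+ (if c then g y else 0))
                        (dec-false (toℕ y Nat.<? k) (NP.<-irrefl y≡k)) (dec-true (y ≟ y) refl)))
    cell i (no i≢y) =
      trans (cong (λ b → if b ∧ not (X i) then deg D i Nat.* deg D i else 0)
                  (does-<?-suc (λ i≡k → i≢y (FP.toℕ-injective (trans i≡k (sym y≡k))))))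
            (sym (trans (cong (λ c → f k i Nat.+ (if c then g i else 0)) (dec-false (i ≟ y) i≢y)) (NP.+-identityʳ _)))

  Within : ℕ → (Fin (n D) → Bool) → Set
  Within k V = deviation k V ≤ + (8 Nat.* budget k)

  private
    budget-arith : ∀ b d → + (8 Nat.* b) + + (2 Nat.* (2 Nat.* d Nat.* (2 Nat.* d))) ≡ + (8 Nat.* (b Nat.+ d Nat.* d))
    budget-arith b d = trans (sym (ZP.pos-+ (8 Nat.* b) _)) (cong +_ (lemma b d))
      where
      open import Data.Nat.Tactic.RingSolver using (solve-∀)
      lemma : ∀ b d → 8 Nat.* b Nat.+ 2 Nat.* (2 Nat.* d Nat.* (2 Nat.* d)) ≡ 8 Nat.* (b Nat.+ d Nat.* d)
      lemma = solve-∀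

  place : ∀ {k y} → toℕ y ≡ k → ∀ V → Within k V → Σ (Fin (n D) → Bool) (Within (suc k))
  place {k} {y} y≡k V within with X y in Xy
  ... | true  = V , subst₂ (λ s t → sq (+ s - + Φ 0 V₀) + sq (+ t - + Φ 0 (not ∘ V₀)) ≤ + (8 Nat.* budget (suc k)))
                           (sym (Φ-stay y≡k Xy V)) (sym (Φ-stay y≡k Xy (not ∘ V)))
                           (subst (λ t → deviation k V ≤ + (8 Nat.* t))
                                  (sym (trans (budget-step y≡k) (trans (cong (λ b → budget k Nat.+ (if not b then deg D y Nat.* deg D y else 0)) Xy)
                                                                          (NP.+-identityʳ (budget k))))) within)
  ... | false = choose (balanced-choice (2 Nat.* deg D y) (+ Φ 0 V₀) (+ Φ 0 (not ∘ V₀))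
                          (Φ-average y≡k Xy agree₁ agree₀ (VP.updateAt-updates y V) (VP.updateAt-updates y V))
                          (trans (NP.+-comm (Φ (suc k) (not ∘ V₁)) _)
                                 (Φ-average y≡k Xy (flip agree₀) (flip agree₁)
                                            (cong not (VP.updateAt-updates y V)) (cong not (VP.updateAt-updates y V))))
                          (Φ-step-≤ y≡k Xy agree₁) (Φ-step-≤ y≡k Xy agree₀)
                          (Φ-step-≤ y≡k Xy (flip agree₁)) (Φ-step-≤ y≡k Xy (flip agree₀)))
    where
    V₁ V₀′ : Fin (n D) → Bool
    V₁  = updateAt V y (const true)
    V₀′ = updateAt V y (const false)
    agree₁ : Agree y V V₁
    agree₁ i i≢y = VP.updateAt-minimal i y V i≢y
    agree₀ : Agree y V V₀′
    agree₀ i i≢y = VP.updateAt-minimal i y V i≢y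
    flip : ∀ {W} → Agree y V W → Agree y (not ∘ V) (not ∘ W)
    flip W≈V i i≢y = cong not (W≈V i i≢y)
    grow : ∀ {W} → deviation (suc k) W ≤ deviation k V + + (2 Nat.* (2 Nat.* deg D y Nat.* (2 Nat.* deg D y))) →
           Within (suc k) W
    grow closer = ZP.≤-trans closer (ZP.≤-trans (ZP.+-monoˡ-≤ _ within)
                    (ZP.≤-reflexive (trans (budget-arith (budget k) (deg D y))
                                           (cong (λ t → + (8 Nat.* t)) (sym (trans (budget-step y≡k)
                                              (cong (λ b → budget k Nat.+ (if not b then deg D y Nat.* deg D y else 0)) Xy)))))))
    choose : _ → Σ (Fin (n D) → Bool) (Within (suc k))
    choose (inj₁ closer) = V₁ , grow {V₁} closer
    choose (inj₂ closer) = V₀′ , grow {V₀′} closer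

  placement : ∀ k → k Nat.≤ n D → Σ (Fin (n D) → Bool) (Within k)
  placement zero    _   = V₀ , subst (_≤ + (8 Nat.* budget 0)) (sym start) (Int.+≤+ z≤n)
    where
    start : deviation 0 V₀ ≡ + 0
    start = cong₂ (λ s t → sq s + sq t) (ZP.+-inverseʳ (+ Φ 0 V₀)) (ZP.+-inverseʳ (+ Φ 0 (not ∘ V₀)))
  placement (suc k) k<N = place (FP.toℕ-fromℕ< k<N) (proj₁ previous) (proj₂ previous)
    where
    previous : Σ (Fin (n D) → Bool) (Within k)
    previous = placement k (NP.<⇒≤ k<N)

  budget-≤ : ∀ M → (∀ y → X y ≡ false → deg D y Nat.≤ M) → budget (n D) Nat.≤ M Nat.* (2 Nat.* arcs D)
  budget-≤ M deg≤M = begin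
    budget (n D)                    ≤⟨ ℕΣ.sum-mono-≤ (λ y → if-≤ _ (λ c → NP.*-monoˡ-≤ (deg D y) (deg≤M y (∧-not-true _ (X y) c)))) ⟩
    ℕΣ.sum (λ y → M Nat.* deg D y)  ≡⟨ ℕΣ.*-distribˡ-sum M (deg D) ⟨
    M Nat.* ℕΣ.sum (deg D)          ≡⟨ cong (M Nat.*_) (handshake D) ⟩
    M Nat.* (2 Nat.* arcs D)        ∎
    where
    open NP.≤-Reasoning
    if-≤ : ∀ b {x t} → (b ≡ true → x Nat.≤ t) → (if b then x else 0) Nat.≤ t
    if-≤ true  x≤t = x≤t refl
    if-≤ false _   = z≤n
    ∧-not-true : ∀ c x → c ∧ not x ≡ true → x ≡ false
    ∧-not-true true false _ = refl

module _ where
  open Int using (_+_; _-_; _≤_)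
  open import Data.Integer.Tactic.RingSolver using (solve-∀)

  private
    ≤-+-sq : ∀ i {j} → + 0 ≤ j → i ≤ i + j
    ≤-+-sq i 0≤j = subst (_≤ i + _) (ZP.+-identityʳ i) (ZP.+-monoʳ-≤ i 0≤j)

  NearExpected : (D : Digraph) (X X₁ : VSet D) (M : ℕ) → VSet D → Set
  NearExpected D X X₁ M V =
    (sq (+ (4 Nat.* e D V (compl {D} V)) - (+ arcs D + gap D X X₁)) ≤ + (16 Nat.* M Nat.* arcs D)) ×
    (sq (+ (4 Nat.* e D (compl {D} V) V) - (+ arcs D - gap D X X₁)) ≤ + (16 Nat.* M Nat.* arcs D))

  near-expected-cuts : (D : Digraph) (X X₁ : VSet D) (M : ℕ) → Independent D X → _⊆_ {D} X₁ X →
    (∀ y → X y ≡ false → deg D y Nat.≤ M) → Σ (VSet D) (NearExpected D X X₁ M)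
  near-expected-cuts D X X₁ M indep X₁⊆X deg≤M =
    V , ZP.≤-trans (≤-+-sq (sq forward) (sq-nonneg backward)) total
      , ZP.≤-trans (subst (_≤ sq forward + sq backward) (ZP.+-identityˡ (sq backward))
                          (ZP.+-monoˡ-≤ (sq backward) (sq-nonneg forward))) total
    where
    open ExpectedCut D X
    open GreedyPlacement D X X₁
    V : VSet D
    V = proj₁ (placement (n D) NP.≤-refl)
    m : ℕ
    m = arcs D
    forward backward : ℤ
    forward  = + (4 Nat.* e D V (compl {D} V)) - (+ m + gap D X X₁)
    backward = + (4 Nat.* e D (compl {D} V) V) - (+ m - gap D X X₁)
    total : sq forward + sq backward ≤ + (16 Nat.* M Nat.* m)
    total = begin
      sq forward + sq backward
        ≡⟨ cong₂ (λ s t → sq s + sq t)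
                 (cong₂ (λ s t → + s - t) (Φ-complete V) (Φ-initial-gap indep X₁⊆X))
                 (cong₂ (λ s t → + s - t) (trans (Φ-complete (not ∘ V)) (cong (4 Nat.*_) (e-cong D {compl {D} V} {compl {D} V} (λ _ → refl) (BP.not-involutive ∘ V))))
                        (Φ-initial-gap-reversed indep X₁⊆X)) ⟨
      deviation (n D) V
        ≤⟨ proj₂ (placement (n D) NP.≤-refl) ⟩
      + (8 Nat.* budget (n D))
        ≤⟨ Int.+≤+ (NP.*-monoʳ-≤ 8 (budget-≤ M deg≤M)) ⟩
      + (8 Nat.* (M Nat.* (2 Nat.* m)))
        ≡⟨ cong +_ (sixteen M m) ⟩
      + (16 Nat.* M Nat.* m) ∎
      where
      open ZP.≤-Reasoning
      sixteen : ∀ M m → 8 Nat.* (M Nat.* (2 Nat.* m)) ≡ 16 Nat.* M Nat.* m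
      sixteen = NatSolver.solve-∀

module _ where
  open import Data.Rational using (_+_; _-_; _*_; _≤_; _<_; 0ℚ; 1ℚ; NonNegative)
  import Data.Rational.Properties as QP
  open import Data.Rational.Solver using (module +-*-Solver)
  open +-*-Solver using (solve; _:+_; _:*_; :-_; _:-_; _:=_; con)

  ι : ℤ → ℚ
  ι z = z ℚ./ 1

  private
    ι≡mkℚ : ∀ z → ι z ≡ ℚ.mkℚ z 0 (Coprime.sym (Coprime.1-coprimeTo Int.∣ z ∣))
    ι≡mkℚ z = QP.↥p/↧p≡p (ℚ.mkℚ z 0 (Coprime.sym (Coprime.1-coprimeTo Int.∣ z ∣)))

  ι-+ : ∀ x y → ι (x Int.+ y) ≡ ι x + ι y
  ι-+ x y = sym (trans (cong₂ _+_ (ι≡mkℚ x) (ι≡mkℚ y))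
                       (cong (ℚ._/ 1) (cong₂ Int._+_ (ZP.*-identityʳ x) (ZP.*-identityʳ y))))

  ι-* : ∀ x y → ι (x Int.* y) ≡ ι x * ι y
  ι-* x y = sym (cong₂ _*_ (ι≡mkℚ x) (ι≡mkℚ y))

  ι-mono-≤ : ∀ {x y} → x Int.≤ y → ι x ≤ ι y
  ι-mono-≤ {x} {y} x≤y = subst₂ _≤_ (sym (ι≡mkℚ x)) (sym (ι≡mkℚ y))
                           (ℚ.*≤* (subst₂ Int._≤_ (sym (ZP.*-identityʳ x)) (sym (ZP.*-identityʳ y)) x≤y))

  ℚ[]-nonneg : ∀ k → 0ℚ ≤ ℚ[ k ]
  ℚ[]-nonneg k = ι-mono-≤ {+ 0} {+ k} (Int.+≤+ z≤n)

  neg≤-of-sq≤ : ∀ x y → 0ℚ ≤ y → x * x ≤ y * y → ℚ.- y ≤ x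
  neg≤-of-sq≤ x y 0≤y x²≤y² with ℚ.- y QP.≤? x
  ... | yes -y≤x = -y≤x
  ... | no  -y≰x = ⊥-elim (QP.<-irrefl refl (QP.≤-<-trans x²≤y² y²<x²))
    where
    x<-y : x < ℚ.- y
    x<-y = QP.≰⇒> -y≰x
    y<-x : y < ℚ.- x
    y<-x = subst (_< ℚ.- x) (solve 1 (λ y → :- (:- y) := y) refl y) (QP.neg-antimono-< x<-y)
    instance
      -x-pos : ℚ.Positive (ℚ.- x)
      -x-pos = ℚ.positive (QP.≤-<-trans 0≤y y<-x)
      y-nonneg : NonNegative y
      y-nonneg = ℚ.nonNegative 0≤y
    y²<x² : y * y < x * x
    y²<x² = subst (y * y <_) (solve 1 (λ x → (:- x) :* (:- x) := x :* x) refl x)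
              (QP.≤-<-trans (QP.*-monoʳ-≤-nonNeg y (QP.<⇒≤ y<-x)) (QP.*-monoʳ-<-pos (ℚ.- x) y<-x))

  *-nonneg : ∀ {p q} → 0ℚ ≤ p → 0ℚ ≤ q → 0ℚ ≤ p * q
  *-nonneg {p} {q} 0≤p 0≤q = subst (_≤ p * q) (QP.*-zeroˡ q) (QP.*-monoʳ-≤-nonNeg q {{ℚ.nonNegative 0≤q}} 0≤p)

  halve-≤ : ∀ x y → x + x ≤ y + y → x ≤ y
  halve-≤ x y x+x≤y+y with x QP.≤? y
  ... | yes x≤y = x≤y
  ... | no  x≰y = ⊥-elim (QP.<-irrefl refl (QP.≤-<-trans x+x≤y+y (QP.+-mono-< (QP.≰⇒> x≰y) (QP.≰⇒> x≰y))))

  ℚ[+] : ∀ a b → ℚ[ a Nat.+ b ] ≡ ℚ[ a ] + ℚ[ b ]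
  ℚ[+] a b = trans (cong ι (ZP.pos-+ a b)) (ι-+ (+ a) (+ b))

  ℚ[*] : ∀ a b → ℚ[ a Nat.* b ] ≡ ℚ[ a ] * ℚ[ b ]
  ℚ[*] a b = trans (cong ι (ZP.pos-* a b)) (ι-* (+ a) (+ b))

  ℚ[4*] : ∀ k → ℚ[ 4 Nat.* k ] ≡ ℚ[ k ] + ℚ[ k ] + ℚ[ k ] + ℚ[ k ]
  ℚ[4*] k = trans (cong ℚ[_] (four k))
                  (trans (ℚ[+] (k Nat.+ k Nat.+ k) k) (cong (_+ ℚ[ k ]) (trans (ℚ[+] (k Nat.+ k) k) (cong (_+ ℚ[ k ]) (ℚ[+] k k)))))
    where
    four : ∀ k → 4 Nat.* k ≡ k Nat.+ k Nat.+ k Nat.+ k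
    four = NatSolver.solve-∀

  private
    gap-nonneg : ∀ {p q} → p ≤ q → 0ℚ ≤ q - p
    gap-nonneg {p} {q} p≤q = subst (_≤ q - p) (QP.+-inverseʳ p) (QP.+-monoˡ-≤ (ℚ.- p) p≤q)

    nonneg-gap⇒≤ : ∀ p q → 0ℚ ≤ q - p → p ≤ q
    nonneg-gap⇒≤ p q 0≤q-p = subst₂ _≤_ (QP.+-identityʳ p) (solve 2 (λ p q → p :+ (q :- p) := q) refl p q)
                                     (QP.+-monoʳ-≤ p 0≤q-p)

  -- a² ≤ 16Mm ≤ 4ε²m² = (2εm)²
  deviation-≥ : ∀ m M (a : ℤ) ε → sq a Int.≤ + (16 Nat.* M Nat.* m) → ℚ[ 4 ] * ℚ[ M ] ≤ ε * ε * ℚ[ m ] →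
                0ℚ ≤ ε → 0ℚ ≤ ι a + (ε * ℚ[ m ] + ε * ℚ[ m ])
  deviation-≥ m M a ε a²≤ 4M≤ 0≤ε =
    subst (_≤ ι a + (q + q)) (QP.+-inverseˡ (q + q)) (QP.+-monoˡ-≤ (q + q) (neg≤-of-sq≤ (ι a) (q + q) 0≤2q (begin
      ι a * ι a                            ≡⟨ ι-* a a ⟨
      ι (a Int.* a)                        ≤⟨ ι-mono-≤ a²≤ ⟩
      ℚ[ 16 Nat.* M Nat.* m ]              ≡⟨ trans (cong ℚ[_] (regroup M m)) (trans (ℚ[*] (4 Nat.* M) (4 Nat.* m)) (cong (_* ℚ[ 4 Nat.* m ]) (ℚ[*] 4 M))) ⟩
      ℚ[ 4 ] * ℚ[ M ] * ℚ[ 4 Nat.* m ]     ≤⟨ QP.*-monoʳ-≤-nonNeg ℚ[ 4 Nat.* m ] {{ℚ.nonNegative (ℚ[]-nonneg (4 Nat.* m))}} 4M≤ ⟩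
      ε * ε * m̂ * ℚ[ 4 Nat.* m ]           ≡⟨ cong (λ t → ε * ε * m̂ * t) (ℚ[4*] m) ⟩
      ε * ε * m̂ * (m̂ + m̂ + m̂ + m̂)         ≡⟨ solve 2 (λ e m → e :* e :* m :* (m :+ m :+ m :+ m) := (e :* m :+ e :* m) :* (e :* m :+ e :* m)) refl ε m̂ ⟩
      (q + q) * (q + q)                    ∎)))
    where
    open QP.≤-Reasoning
    m̂ q : ℚ
    m̂ = ℚ[ m ]
    q = ε * m̂
    0≤q : 0ℚ ≤ q
    0≤q = *-nonneg 0≤ε (ℚ[]-nonneg m)
    0≤2q : 0ℚ ≤ q + q
    0≤2q = QP.+-mono-≤ 0≤q 0≤q
    regroup : ∀ M m → 16 Nat.* M Nat.* m ≡ 4 Nat.* M Nat.* (4 Nat.* m)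
    regroup = NatSolver.solve-∀

  ℚ[2d-1] : ∀ d′ → ℚ[ 2 Nat.* suc d′ ∸ 1 ] ≡ ℚ[ d′ ] + ℚ[ d′ ] + 1ℚ
  ℚ[2d-1] d′ = trans (cong ℚ[_] (odd d′)) (trans (ℚ[+] (d′ Nat.+ d′) 1) (cong (_+ 1ℚ) (ℚ[+] d′ d′)))
    where
    odd : ∀ d′ → d′ Nat.+ suc (d′ Nat.+ 0) ≡ d′ Nat.+ d′ Nat.+ 1
    odd = NatSolver.solve-∀

  ι-deviation : ∀ E m g → ι (+ (4 Nat.* E) Int.- (+ m Int.+ g)) ≡ ℚ[ E ] + ℚ[ E ] + ℚ[ E ] + ℚ[ E ] - ℚ[ m ] - ι g
  ι-deviation E m g = begin
    A                                  ≡⟨ solve 3 (λ m g a → a := m :+ g :+ a :- m :- g) refl ℚ[ m ] (ι g) A ⟩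
    ℚ[ m ] + ι g + A - ℚ[ m ] - ι g    ≡⟨ cong (λ t → t - ℚ[ m ] - ι g) (trans (ι-+ (+ m Int.+ g) a) (cong (_+ A) (ι-+ (+ m) g))) ⟨
    ι (+ m Int.+ g Int.+ a) - ℚ[ m ] - ι g ≡⟨ cong (λ t → ι t - ℚ[ m ] - ι g) (split (+ (4 Nat.* E)) (+ m Int.+ g)) ⟨
    ℚ[ 4 Nat.* E ] - ℚ[ m ] - ι g      ≡⟨ cong (λ t → t - ℚ[ m ] - ι g) (ℚ[4*] E) ⟩
    ℚ[ E ] + ℚ[ E ] + ℚ[ E ] + ℚ[ E ] - ℚ[ m ] - ι g ∎
    where
    open ≡-Reasoning
    a : ℤ
    a = + (4 Nat.* E) Int.- (+ m Int.+ g)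
    A : ℚ
    A = ι a
    split : ∀ x y → x ≡ y Int.+ (x Int.- y)
    split = IntSolver.solve-∀

  private
    -- each summand is nonnegative in cut-bound, where their total is 2(R − L)
    summands : ℚ → ℚ → ℚ → ℚ → ℚ → ℚ → ℚ
    summands m̂ θ̂ G q W A = (m̂ - θ̂ * W) + W * (θ̂ + G) + W * (A + (q + q)) + (W * q + W * q)

  -- With a = 4E − (m + g): 4E ≥ m − θ − 2εm, and θ(2d − 1) ≤ m.
  cut-bound : ∀ (m θ d M E : ℕ) (g : ℤ) (ε : ℚ) → ℚ.Positive ε → 1 Nat.≤ d →
    - + θ Int.≤ g →
    sq (+ (4 Nat.* E) Int.- (+ m Int.+ g)) Int.≤ + (16 Nat.* M Nat.* m) →
    ℚ[ 4 ] * ℚ[ M ] ≤ ε * ε * ℚ[ m ] →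
    θ Nat.* (2 Nat.* d ∸ 1) Nat.≤ m →
    (ℚ[ d ∸ 1 ] - ℚ[ 2 Nat.* (2 Nat.* d ∸ 1) ] * ε) * ℚ[ m ] ≤ ℚ[ 2 Nat.* (2 Nat.* d ∸ 1) ] * ℚ[ E ]
  cut-bound m θ (suc d′) M E g ε ε>0 _ -θ≤g a²≤ 4M≤ θw≤m =
    nonneg-gap⇒≤ L R (halve-≤ 0ℚ (R - L) (subst (0ℚ ≤_) total≡ total-nonneg))
    where
    w : ℕ
    w = 2 Nat.* suc d′ ∸ 1
    a : ℤ
    a = + (4 Nat.* E) Int.- (+ m Int.+ g)
    W Dq m̂ Ê θ̂ G q L R : ℚ
    W  = ℚ[ w ]
    Dq = ℚ[ d′ ]
    m̂  = ℚ[ m ]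
    Ê  = ℚ[ E ]
    θ̂  = ℚ[ θ ]
    G  = ι g
    q  = ε * m̂
    L  = (Dq - ℚ[ 2 Nat.* w ] * ε) * m̂
    R  = ℚ[ 2 Nat.* w ] * Ê
    0≤ε : 0ℚ ≤ ε
    0≤ε = QP.<⇒≤ (QP.positive⁻¹ ε {{ε>0}})
    0≤q : 0ℚ ≤ q
    0≤q = *-nonneg 0≤ε (ℚ[]-nonneg m)
    0≤θ+G : 0ℚ ≤ θ̂ + G
    0≤θ+G = subst (0ℚ ≤_) (ι-+ (+ θ) g) (ι-mono-≤ (subst (Int._≤ + θ Int.+ g) (ZP.+-inverseʳ (+ θ)) (ZP.+-monoʳ-≤ (+ θ) -θ≤g)))
    θW≤m : θ̂ * W ≤ m̂
    θW≤m = subst (_≤ m̂) (ℚ[*] θ w) (ι-mono-≤ (Int.+≤+ θw≤m))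
    0≤W : 0ℚ ≤ W
    0≤W = ℚ[]-nonneg w
    total-nonneg : 0ℚ ≤ summands m̂ θ̂ G q W (ι a)
    total-nonneg = QP.+-mono-≤ (QP.+-mono-≤ (QP.+-mono-≤ (gap-nonneg θW≤m) (*-nonneg 0≤W 0≤θ+G))
                                            (*-nonneg 0≤W (deviation-≥ m M a ε a²≤ 4M≤ 0≤ε)))
                               (QP.+-mono-≤ (*-nonneg 0≤W 0≤q) (*-nonneg 0≤W 0≤q))
    total≡ : summands m̂ θ̂ G q W (ι a) ≡ (R - L) + (R - L)
    total≡ = begin
      summands m̂ θ̂ G q W (ι a)
        ≡⟨ cong₂ (summands m̂ θ̂ G q) (ℚ[2d-1] d′) (ι-deviation E m g) ⟩
      summands m̂ θ̂ G q (Dq + Dq + 1ℚ) (Ê + Ê + Ê + Ê - m̂ - G)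
        ≡⟨ solve 6 (λ d e m g t ε →
             (m :- t :* (d :+ d :+ con 1ℚ)) :+ (d :+ d :+ con 1ℚ) :* (t :+ g)
             :+ (d :+ d :+ con 1ℚ) :* ((e :+ e :+ e :+ e :- m :- g) :+ (ε :* m :+ ε :* m))
             :+ ((d :+ d :+ con 1ℚ) :* (ε :* m) :+ (d :+ d :+ con 1ℚ) :* (ε :* m))
             := (((d :+ d :+ con 1ℚ) :+ (d :+ d :+ con 1ℚ)) :* e :- (d :- ((d :+ d :+ con 1ℚ) :+ (d :+ d :+ con 1ℚ)) :* ε) :* m)
                :+ (((d :+ d :+ con 1ℚ) :+ (d :+ d :+ con 1ℚ)) :* e :- (d :- ((d :+ d :+ con 1ℚ) :+ (d :+ d :+ con 1ℚ)) :* ε) :* m))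
             refl Dq Ê m̂ G θ̂ ε ⟩
      (R′ - L′) + (R′ - L′)
        ≡⟨ cong (λ t → (t * Ê - (Dq - t * ε) * m̂) + (t * Ê - (Dq - t * ε) * m̂))
                (trans (trans (cong (λ t → ℚ[ w Nat.+ t ]) (NP.+-identityʳ w)) (ℚ[+] w w)) (cong₂ _+_ (ℚ[2d-1] d′) (ℚ[2d-1] d′))) ⟨
      (R - L) + (R - L) ∎
      where
      open ≡-Reasoning
      R′ L′ : ℚ
      R′ = ((Dq + Dq + 1ℚ) + (Dq + Dq + 1ℚ)) * Ê
      L′ = (Dq - ((Dq + Dq + 1ℚ) + (Dq + Dq + 1ℚ)) * ε) * m̂

module _ where
  open Int using (_+_; _-_; _≤_; _<_)

  signed : Bool → ℤ → ℤ
  signed b z = if b then z else - z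

  signed-sum : ∀ {p} → (Fin p → Bool) → (Fin p → ℤ) → ℤ
  signed-sum σ d = ℤΣ.sum (λ i → signed (σ i) (d i))

  Window : ℕ → ℤ → Set
  Window θ z = (- + θ < z) × (z < + θ)

  window⇒∣∣< : ∀ {θ} z → Window θ z → Int.∣ z ∣ Nat.< θ
  window⇒∣∣< (+ k)        (_ , Int.+<+ k<θ) = k<θ
  window⇒∣∣< Int.-[1+ k ] (-θ<z , _)       = ZP.drop‿+<+ (ZP.neg-cancel-< -θ<z)

  window-neg : ∀ {θ z} → Window θ z → Window θ (- z)
  window-neg {θ} {z} (-θ<z , z<θ) =
    ZP.neg-mono-< z<θ , subst (- z <_) (ZP.neg-involutive (+ θ)) (ZP.neg-mono-< -θ<z)

  private
    window-opposite : ∀ {θ x t} → Window θ x → Window θ t → + 0 ≤ x → t ≤ + 0 → Window θ (x + t)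
    window-opposite {θ} {x} {t} (_ , x<θ) (-θ<t , _) 0≤x t≤0 =
      ZP.<-≤-trans -θ<t (subst (_≤ x + t) (ZP.+-identityˡ t) (ZP.+-monoˡ-≤ t 0≤x)) ,
      ZP.≤-<-trans (subst (x + t ≤_) (ZP.+-identityʳ x) (ZP.+-monoʳ-≤ x t≤0)) x<θ

    step-from-above : ∀ {θ x d} → Window θ x → Window θ d → + 0 ≤ x → Σ Bool λ b → Window θ (x + signed b d)
    step-from-above {θ} {x} {d} wx wd 0≤x with + 0 ZP.≤? d
    ... | yes 0≤d = false , window-opposite wx (window-neg wd) 0≤x (ZP.neg-mono-≤ 0≤d)
    ... | no  0≰d = true  , window-opposite wx wd 0≤x (ZP.<⇒≤ (ZP.≰⇒> 0≰d))

    reflect : ∀ b x d → - (- x + signed b d) ≡ x + signed (not b) d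
    reflect true  = lemma
      where
      lemma : ∀ x d → - (- x + d) ≡ x + - d
      lemma = IntSolver.solve-∀
    reflect false = lemma
      where
      lemma : ∀ x d → - (- x + - d) ≡ x + d
      lemma = IntSolver.solve-∀

  -- add ±d with the sign opposite to that of x
  window-step : ∀ {θ x d} → Window θ x → Window θ d → Σ Bool λ b → Window θ (x + signed b d)
  window-step {θ} {x} {d} wx wd with + 0 ZP.≤? x
  ... | yes 0≤x = step-from-above wx wd 0≤x
  ... | no  0≰x =
    let b , w = step-from-above (window-neg wx) wd (ZP.neg-mono-≤ (ZP.<⇒≤ (ZP.≰⇒> 0≰x)))
    in  not b , subst (Window θ) (reflect b x d) (window-neg w)

  window-walk : ∀ θ {p} (d : Fin p → ℤ) x → (∀ i → Window θ (d i)) → Window θ x →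
                Σ (Fin p → Bool) λ σ → Window θ (x + signed-sum σ d)
  window-walk θ {zero}  d x _      wx = (λ ()) , subst (Window θ) (sym (ZP.+-identityʳ x)) wx
  window-walk θ {suc p} d x window wx =
    let b , wx′ = window-step wx (window zero)
        σ , wend = window-walk θ (d ∘ suc) (x + signed b (d zero)) (window ∘ suc) wx′
    in  (λ { zero → b ; (suc i) → σ i }) , subst (Window θ) (ZP.+-assoc x _ _) wend

  -- Until the walk first enters the window it adds every d i with sign +; if it never does,
  -- it ends at or below -θ.
  window-walk-or-undershoot : ∀ θ {p} (d : Fin p → ℤ) x → (∀ i → Window θ (d i)) → x < + θ →
    (Σ (Fin p → Bool) λ σ → Window θ (x + signed-sum σ d)) ⊎ (x + ℤΣ.sum d ≤ - + θ)
  window-walk-or-undershoot θ {p} d x window x<θ with x ZP.≤? - + θ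
  ... | no  x≰-θ = inj₁ (window-walk θ d x window (ZP.≰⇒> x≰-θ , x<θ))
  window-walk-or-undershoot θ {zero} d x window x<θ | yes x≤-θ = inj₂ (subst (_≤ - + θ) (sym (ZP.+-identityʳ x)) x≤-θ)
  window-walk-or-undershoot θ {suc p} d x window x<θ | yes x≤-θ
    with window-walk-or-undershoot θ (d ∘ suc) (x + d zero) (window ∘ suc) x+d<θ
    where
    x+d<θ : x + d zero < + θ
    x+d<θ = ZP.<-≤-trans (ZP.+-mono-≤-< x≤-θ (proj₂ (window zero)))
                         (ZP.≤-trans (ZP.≤-reflexive (ZP.+-inverseˡ (+ θ))) (Int.+≤+ z≤n))
  ... | inj₁ (σ , wend) = inj₁ ((λ { zero → true ; (suc i) → σ i }) , subst (Window θ) (ZP.+-assoc x _ _) wend)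
  ... | inj₂ below      = inj₂ (subst (_≤ - + θ) (ZP.+-assoc x _ _) below)

IsEnumeration : ∀ {n c} → (Fin n → Bool) → (Fin c → Fin n) → Set
IsEnumeration A v = Injective _≡_ _≡_ v × (∀ j → A (v j) ≡ true) × (∀ x → A x ≡ true → ∃ λ j → v j ≡ x)

enumerate : ∀ {n} (A : Fin n → Bool) → Σ ℕ λ c → (c ≡ ℕΣ.sum (b2n ∘ A)) × Σ (Fin c → Fin n) (IsEnumeration A)
enumerate {zero}  A = 0 , refl , (λ ()) , (λ {}) , (λ ()) , (λ ())
enumerate {suc n} A with enumerate (A ∘ suc) | A zero in A0
... | c , c≡ , v , injective , inside , onto | true = suc c , cong suc c≡ , v′ , injective′ , inside′ , onto′
  where
  v′ : Fin (suc c) → Fin (suc n)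
  v′ zero    = zero
  v′ (suc j) = suc (v j)
  injective′ : Injective _≡_ _≡_ v′
  injective′ {zero}  {zero}  _  = refl
  injective′ {suc i} {suc j} eq = cong suc (injective (FP.suc-injective eq))
  inside′ : ∀ j → A (v′ j) ≡ true
  inside′ zero    = A0
  inside′ (suc j) = inside j
  onto′ : ∀ x → A x ≡ true → ∃ λ j → v′ j ≡ x
  onto′ zero    _  = zero , refl
  onto′ (suc x) Ax = let j , vj≡x = onto x Ax in suc j , cong suc vj≡x
... | c , c≡ , v , injective , inside , onto | false = c , c≡ , suc ∘ v , injective ∘ FP.suc-injective , inside , onto′
  where
  onto′ : ∀ x → A x ≡ true → ∃ λ j → suc (v j) ≡ x
  onto′ zero    A0′ with () ← trans (sym A0′) A0
  onto′ (suc x) Ax  = let j , vj≡x = onto x Ax in j , cong suc vj≡x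

inImage : ∀ {p q} → (Fin p → Fin q) → Fin q → Bool
inImage φ y = does (FP.any? (λ j → y ≟ φ j))

inImage-enumeration : ∀ {n c} {A : Fin n → Bool} {v : Fin c → Fin n} → IsEnumeration A v → ∀ x → inImage v x ≡ A x
inImage-enumeration {A = A} {v} (_ , inside , onto) x with A x in Ax
... | true  = let j , vj≡x = onto x Ax in dec-true (FP.any? (λ j → x ≟ v j)) (j , sym vj≡x)
... | false = dec-false (FP.any? (λ j → x ≟ v j)) (λ { (j , refl) → case trans (sym (inside j)) Ax of λ () })

module _ where
  open Int using (_+_)

  sum-image : ∀ {p q} (φ : Fin p → Fin q) → Injective _≡_ _≡_ φ → (f : Fin q → ℤ) →
              ℤΣ.sum (f ∘ φ) ≡ ℤΣ.sum (λ y → if inImage φ y then f y else + 0)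
  sum-image {zero}  {q} φ _         f = sym (ℤΣ.sum-replicate-zero q)
  sum-image {suc p} {q} φ injective f = begin
    f (φ zero) + ℤΣ.sum (f ∘ φ ∘ suc)
      ≡⟨ cong₂ _+_ (ℤΣ.sum-indicator (φ zero) f) (sym (sum-image (φ ∘ suc) (FP.suc-injective ∘ injective) f)) ⟨
    ℤΣ.sum (λ y → if does (y ≟ φ zero) then f y else + 0) + ℤΣ.sum (λ y → if inImage (φ ∘ suc) y then f y else + 0)
      ≡⟨ ℤΣ.∑-distrib-+ (λ y → if does (y ≟ φ zero) then f y else + 0) (λ y → if inImage (φ ∘ suc) y then f y else + 0) ⟨
    ℤΣ.sum (λ y → (if does (y ≟ φ zero) then f y else + 0) + (if inImage (φ ∘ suc) y then f y else + 0))
      ≡⟨ ℤΣ.sum-cong-≗ (λ y → disjoint-∨ (y ≟ φ zero) (f y) (first≢rest y)) ⟩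
    ℤΣ.sum (λ y → if inImage φ y then f y else + 0)
      ∎
    where
    open ≡-Reasoning
    first≢rest : ∀ y → y ≡ φ zero → inImage (φ ∘ suc) y ≡ false
    first≢rest y refl = dec-false (FP.any? (λ j → φ zero ≟ φ (suc j))) (λ { (j , eq) → FP.0≢1+n (injective eq) })
    disjoint-∨ : ∀ {y} (y? : Dec (y ≡ φ zero)) c → (y ≡ φ zero → inImage (φ ∘ suc) y ≡ false) →
      (if does y? then c else + 0) + (if inImage (φ ∘ suc) y then c else + 0) ≡ (if does y? ∨ inImage (φ ∘ suc) y then c else + 0)
    disjoint-∨ (yes y≡) c first = trans (cong (λ b → c + (if b then c else + 0)) (first y≡)) (ZP.+-identityʳ c)
    disjoint-∨ (no  _)  c _     = ZP.+-identityˡ _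

weighted-signing : ∀ {n} → (Fin n → Bool) → (Fin n → ℕ) → (Fin n → Bool) → ℤ
weighted-signing A w S = ℤΣ.sum (λ x → if A x then signed (S x) (+ w x) else + 0)

-- The heavy
-- elements (w ≥ θ) pair up into differences inside the window, as does every light weight, so a
-- signing inside the window exists unless one heavy element is left over and outweighs the rest.
module HeavyPairing {n : ℕ} (A : Fin n → Bool) (w : Fin n → ℕ) (θ : ℕ) (0<θ : 0 Nat.< θ)
  (w<2θ : ∀ x → A x ≡ true → w x Nat.< 2 Nat.* θ)
  (unbalanced : ∀ S → θ Nat.≤ Int.∣ weighted-signing A w S ∣) where
  open Int using (_+_; _-_; _≤_; _<_)
  open import Data.Integer.Tactic.RingSolver using (solve-∀)

  heavy : Fin n → Bool
  heavy x = A x ∧ (if θ Nat.≤ᵇ w x then true else false)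

  light : Fin n → ℕ
  light x = if A x ∧ not (heavy x) then w x else 0

  heavy⇒ : ∀ x → heavy x ≡ true → (A x ≡ true) × (θ Nat.≤ w x)
  heavy⇒ x hx with A x | θ Nat.≤ᵇ w x in θ≤ᵇw
  ... | true | true = refl , NP.≤ᵇ⇒≤ θ (w x) (subst T (sym θ≤ᵇw) _)

  window-0 : Window θ (+ 0)
  window-0 = ZP.neg-mono-< (Int.+<+ 0<θ) , Int.+<+ 0<θ

  light-window : ∀ x → Window θ (+ light x)
  light-window x with A x | θ Nat.≤ᵇ w x in θ≤ᵇw
  ... | false | _     = window-0
  ... | true  | true  = window-0
  ... | true  | false = ZP.<-≤-trans (ZP.neg-mono-< (Int.+<+ 0<θ)) (Int.+≤+ z≤n) ,
                        Int.+<+ (NP.≰⇒> (λ θ≤w → subst T θ≤ᵇw (NP.≤⇒≤ᵇ θ≤w)))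

  heavy-difference-window : ∀ {a b} → θ Nat.≤ a → a Nat.< 2 Nat.* θ → θ Nat.≤ b → b Nat.< 2 Nat.* θ →
                            Window θ (+ a - + b)
  heavy-difference-window {a} {b} θ≤a a<2θ θ≤b b<2θ =
    subst (- + θ <_) (swap (+ a) (+ b)) (ZP.neg-mono-< (below θ≤a b<2θ)) , below θ≤b a<2θ
    where
    swap : ∀ a b → - (b - a) ≡ a - b
    swap = solve-∀
    cancel : ∀ t → t + t - t ≡ t
    cancel = solve-∀
    below : ∀ {a b} → θ Nat.≤ b → a Nat.< 2 Nat.* θ → + a - + b < + θ
    below {a} {b} θ≤b a<2θ = ZP.≤-<-trans (ZP.+-monoʳ-≤ (+ a) (ZP.neg-mono-≤ (Int.+≤+ θ≤b)))
      (ZP.<-≤-trans (ZP.+-monoˡ-< (- + θ) (Int.+<+ a<2θ))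
                    (ZP.≤-reflexive (trans (cong (_- + θ) (trans (cong +_ (cong (θ Nat.+_) (NP.+-identityʳ θ))) (ZP.pos-+ θ θ)))
                                           (cancel (+ θ)))))

  module Pairing (k r : ℕ) (v : Fin (2 Nat.* k Nat.+ r) → Fin n) (enumeration : IsEnumeration heavy v) where
    open PairedPositions k r

    wv : Fin (2 Nat.* k Nat.+ r) → ℕ
    wv j = w (v j)

    heavy-v : ∀ j → (θ Nat.≤ wv j) × (wv j Nat.< 2 Nat.* θ)
    heavy-v j = let A-vj , θ≤w = heavy⇒ (v j) (proj₁ (proj₂ enumeration) j) in θ≤w , w<2θ (v j) A-vj

    diff : Fin k → ℤ
    diff i = + wv (first i) - + wv (second i)

    diff-window : ∀ i → Window θ (diff i)
    diff-window i = heavy-difference-window (proj₁ (heavy-v (first i))) (proj₂ (heavy-v (first i)))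
                                            (proj₁ (heavy-v (second i))) (proj₂ (heavy-v (second i)))

    base : ℤ
    base = ℤΣ.sum (λ i → - + wv (extra i))

    -- the pair (first i, second i) is signed (σ i, not σ i), the extra positions negatively
    position-sign : (Fin k → Bool) → Fin (2 Nat.* k Nat.+ r) → Bool
    position-sign σ = (σ ++ ((not ∘ σ) ++ (λ ()))) ++ const false

    signing : (Fin k → Bool) → (Fin n → Bool) → Fin n → Bool
    signing σ ε x = by-position (FP.any? (λ j → x ≟ v j))
      where
      by-position : Dec (∃ λ j → x ≡ v j) → Bool
      by-position (yes (j , _)) = position-sign σ j
      by-position (no _)        = ε x

    module _ (σ : Fin k → Bool) (ε : Fin n → Bool) where

      signing-at : ∀ j → signing σ ε (v j) ≡ position-sign σ j
      signing-at j with FP.any? (λ j′ → v j ≟ v j′)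
      ... | yes (j′ , vj≡vj′) = cong (position-sign σ) (sym (proj₁ enumeration vj≡vj′))
      ... | no  ∄j           = ⊥-elim (∄j (j , refl))

      signing-light : ∀ x → heavy x ≡ false → signing σ ε x ≡ ε x
      signing-light x light-x with FP.any? (λ j → x ≟ v j)
      ... | yes (j , refl) = case trans (sym (proj₁ (proj₂ enumeration) j)) light-x of λ ()
      ... | no  _          = refl

      signed-zero : ∀ b → signed b (+ 0) ≡ + 0
      signed-zero true  = refl
      signed-zero false = refl

      split-cell : ∀ x → (if A x then signed (signing σ ε x) (+ w x) else + 0)
                       ≡ (if heavy x then signed (signing σ ε x) (+ w x) else + 0) + signed (ε x) (+ light x)
      split-cell x = by-cases (A x) (heavy x) (signing-light x) (proj₁ ∘ heavy⇒ x)
        where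
        by-cases : ∀ a h {s e z} → (h ≡ false → s ≡ e) → (h ≡ true → a ≡ true) →
          (if a then signed s (+ z) else + 0) ≡ (if h then signed s (+ z) else + 0) + signed e (+ (if a ∧ not h then z else 0))
        by-cases true  true  {s} {e} {z} _ _ = sym (trans (cong (λ t → signed s (+ z) + t) (signed-zero e)) (ZP.+-identityʳ _))
        by-cases true  false         s≡e _   = trans (cong (λ b → signed b _) (s≡e refl)) (sym (ZP.+-identityˡ _))
        by-cases false true          _   h⇒a with () ← h⇒a refl
        by-cases false false {e = e} _   _   = sym (trans (ZP.+-identityˡ _) (signed-zero e))

      pair-cell : ∀ b a c → signed b a + signed (not b) c ≡ signed b (a - c)
      pair-cell true  a c = refl
      pair-cell false a c = lemma a c
        where
        lemma : ∀ a c → - a + c ≡ - (a - c)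
        lemma = solve-∀

      heavy-part : Fin n → ℤ
      heavy-part x = if heavy x then signed (signing σ ε x) (+ w x) else + 0
      by-position : Fin (2 Nat.* k Nat.+ r) → ℤ
      by-position j = signed (position-sign σ j) (+ wv j)
      heavy-sum : ℤΣ.sum heavy-part ≡ base + signed-sum σ diff
      heavy-sum = begin
        ℤΣ.sum heavy-part
          ≡⟨ ℤΣ.sum-cong-≗ (λ x → cong (λ b → if b then signed (signing σ ε x) (+ w x) else + 0) (inImage-enumeration enumeration x)) ⟨
        ℤΣ.sum (λ x → if inImage v x then signed (signing σ ε x) (+ w x) else + 0)
          ≡⟨ sum-image v (proj₁ enumeration) (λ x → signed (signing σ ε x) (+ w x)) ⟨
        ℤΣ.sum (λ j → signed (signing σ ε (v j)) (+ wv j))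
          ≡⟨ ℤΣ.sum-cong-≗ (λ j → cong (λ b → signed b (+ wv j)) (signing-at j)) ⟩
        ℤΣ.sum by-position
          ≡⟨ ℤΣ.sum-paired k r by-position ⟩
        (ℤΣ.sum (by-position ∘ first) + ℤΣ.sum (by-position ∘ second)) + ℤΣ.sum (by-position ∘ extra)
          ≡⟨ cong₂ _+_ (trans (sym (ℤΣ.∑-distrib-+ (by-position ∘ first) (by-position ∘ second)))
                              (ℤΣ.sum-cong-≗ (λ i → trans (cong₂ (λ b c → signed b (+ wv (first i)) + signed c (+ wv (second i)))
                                                                  (at-first i) (at-second i))
                                                           (pair-cell (σ i) _ _))))
                       (ℤΣ.sum-cong-≗ (λ i → cong (λ b → signed b (+ wv (extra i))) (at-extra i))) ⟩
        signed-sum σ diff + base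
          ≡⟨ ZP.+-comm (signed-sum σ diff) base ⟩
        base + signed-sum σ diff
          ∎
        where
        open ≡-Reasoning
        at-first : ∀ i → position-sign σ (first i) ≡ σ i
        at-first i = trans (VP.lookup-++ˡ _ (const false) (i ↑ˡ (k Nat.+ 0))) (VP.lookup-++ˡ σ _ i)
        at-second : ∀ i → position-sign σ (second i) ≡ not (σ i)
        at-second i = trans (VP.lookup-++ˡ _ (const false) (k ↑ʳ (i ↑ˡ 0)))
                            (trans (VP.lookup-++ʳ σ _ (i ↑ˡ 0)) (VP.lookup-++ˡ (not ∘ σ) (λ ()) i))
        at-extra : ∀ i → position-sign σ (extra i) ≡ false
        at-extra i = VP.lookup-++ʳ (σ ++ ((not ∘ σ) ++ (λ ()))) (const false) i

      decompose : weighted-signing A w (signing σ ε) ≡ (base + signed-sum σ diff) + signed-sum ε (+_ ∘ light)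
      decompose = begin
        weighted-signing A w (signing σ ε)
          ≡⟨ ℤΣ.sum-cong-≗ split-cell ⟩
        ℤΣ.sum (λ x → heavy-part x + signed (ε x) (+ light x))
          ≡⟨ ℤΣ.∑-distrib-+ heavy-part (λ x → signed (ε x) (+ light x)) ⟩
        ℤΣ.sum heavy-part + signed-sum ε (+_ ∘ light)
          ≡⟨ cong (_+ signed-sum ε (+_ ∘ light)) heavy-sum ⟩
        (base + signed-sum σ diff) + signed-sum ε (+_ ∘ light)
          ∎
        where open ≡-Reasoning

    outside-window : ∀ σ ε → ¬ Window θ ((base + signed-sum σ diff) + signed-sum ε (+_ ∘ light))
    outside-window σ ε inside =
      NP.<⇒≱ (window⇒∣∣< _ (subst (Window θ) (sym (decompose σ ε)) inside)) (unbalanced (signing σ ε))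

  no-even-enumeration : ∀ k (v : Fin (2 Nat.* k Nat.+ 0) → Fin n) → ¬ IsEnumeration heavy v
  no-even-enumeration k v enumeration =
    let σ , inside₁ = window-walk θ diff (+ 0) diff-window window-0
        ε , inside₂ = window-walk θ (+_ ∘ light) (+ 0 + signed-sum σ diff) light-window inside₁
    in  outside-window σ ε inside₂
    where open Pairing k 0 v enumeration

  private
    <ᵇ-true : ∀ {m n} → m Nat.< n → (m Nat.<ᵇ n) ≡ true
    <ᵇ-true {m} {n} m<n with m Nat.<ᵇ n | NP.<⇒<ᵇ m<n
    ... | true | _ = refl

    <ᵇ-false : ∀ {m n} → n Nat.≤ m → (m Nat.<ᵇ n) ≡ false
    <ᵇ-false {m} {n} n≤m with m Nat.<ᵇ n in m<ᵇn
    ... | false = refl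
    ... | true  = ⊥-elim (NP.<⇒≱ (NP.<ᵇ⇒< m n (subst T (sym m<ᵇn) _)) n≤m)

    rearrange : ∀ l t b L θ → (- l + + 0 + (t - b)) + L ≤ - θ → L + θ ≤ (b + l) - t
    rearrange l t b L θ below = ZP.≤-trans (ZP.+-monoʳ-≤ L (subst (_≤ - X) (ZP.neg-involutive θ) (ZP.neg-mono-≤ below)))
                                           (ZP.≤-reflexive (lemma l t b L))
      where
      X : ℤ
      X = (- l + + 0 + (t - b)) + L
      lemma : ∀ l t b L → L + - ((- l + + 0 + (t - b)) + L) ≡ (b + l) - t
      lemma = solve-∀

  module OddPairing (k : ℕ) (v : Fin (2 Nat.* k Nat.+ 1) → Fin n) (enumeration : IsEnumeration heavy v) where
    open Pairing k 1 v enumeration public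
    open PairedPositions k 1
    top bottom leftover : ℕ
    top      = ℕΣ.sum (wv ∘ first)
    bottom   = ℕΣ.sum (wv ∘ second)
    leftover = wv (extra zero)
    -θ<θ : - + θ < + θ
    -θ<θ = ZP.<-trans (proj₁ window-0) (proj₂ window-0)
    base<θ : base < + θ
    base<θ = ZP.≤-<-trans (subst (_≤ + 0) (sym (ZP.+-identityʳ (- + leftover))) (ZP.neg-mono-≤ (Int.+≤+ z≤n)))
                          (proj₂ window-0)
    private
      first-below : ∀ i → (toℕ (first i) Nat.<ᵇ k) ≡ true
      first-below i = <ᵇ-true (subst (Nat._< k) (sym (trans (FP.toℕ-↑ˡ _ 1) (FP.toℕ-↑ˡ i (k Nat.+ 0)))) (FP.toℕ<n i))
      second-above : ∀ i → (toℕ (second i) Nat.<ᵇ k) ≡ false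
      second-above i = <ᵇ-false (subst (k Nat.≤_) (sym (trans (FP.toℕ-↑ˡ _ 1) (FP.toℕ-↑ʳ k (i ↑ˡ 0)))) (NP.m≤m+n k _))
      extra-above : (toℕ (extra zero) Nat.<ᵇ k) ≡ false
      extra-above = <ᵇ-false (subst (k Nat.≤_) (sym (FP.toℕ-↑ʳ (2 Nat.* k) (zero {0}))) (NP.≤-trans (NP.m≤m+n k _) (NP.m≤m+n _ 0)))
      zeros : ∀ {p} {f : Fin p → ℕ} → (∀ i → f i ≡ 0) → ℕΣ.sum f ≡ 0
      zeros {p} f≗0 = trans (ℕΣ.sum-cong-≗ f≗0) (ℕΣ.sum-replicate-zero p)

    top≡ : ℕΣ.sum (λ j → if toℕ j Nat.<ᵇ k then wv j else 0) ≡ top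
    top≡ = trans (ℕΣ.sum-paired k 1 _)
      (trans (cong₂ (λ s t → s Nat.+ t)
                    (cong₂ (λ s t → s Nat.+ t)
                           (ℕΣ.sum-cong-≗ (λ i → cong (λ b → if b then wv (first i) else 0) (first-below i)))
                           (zeros (λ i → cong (λ b → if b then wv (second i) else 0) (second-above i))))
                    (cong (λ b → (if b then leftover else 0) Nat.+ 0) extra-above))
             (trans (NP.+-identityʳ _) (NP.+-identityʳ top)))
    bottom≡ : ℕΣ.sum (λ j → if toℕ j Nat.<ᵇ k then 0 else wv j) ≡ bottom Nat.+ leftover
    bottom≡ = trans (ℕΣ.sum-paired k 1 _)
      (cong₂ (λ s t → s Nat.+ t)
             (cong₂ (λ s t → s Nat.+ t)
                    (zeros (λ i → cong (λ b → if b then 0 else wv (first i)) (first-below i)))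
                    (ℕΣ.sum-cong-≗ (λ i → cong (λ b → if b then 0 else wv (second i)) (second-above i))))
             (trans (cong (λ b → (if b then 0 else leftover) Nat.+ 0) extra-above) (NP.+-identityʳ leftover)))
    diff-sum : ℤΣ.sum diff ≡ + top - + bottom
    diff-sum = trans (ℤΣ.∑-distrib-+ (λ i → + wv (first i)) (λ i → - + wv (second i)))
                     (sym (cong₂ _+_ (ℤΣ.pos-sum (wv ∘ first)) (trans (cong -_ (ℤΣ.pos-sum (wv ∘ second))) (ℤΣ.neg-sum (λ i → + wv (second i))))))

  -- for every enumeration, not only the sorted one of condition (3)
  odd-enumeration-bound : ∀ k (v : Fin (2 Nat.* k Nat.+ 1) → Fin n) → IsEnumeration heavy v →
    + ℕΣ.sum light + + θ ≤ + ℕΣ.sum (λ j → if toℕ j Nat.<ᵇ k then 0 else w (v j))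
                           - + ℕΣ.sum (λ j → if toℕ j Nat.<ᵇ k then w (v j) else 0)
  odd-enumeration-bound k v enumeration = conclude (window-walk-or-undershoot θ diff base diff-window base<θ)
    where
    open OddPairing k v enumeration
    conclude : (Σ (Fin k → Bool) λ σ → Window θ (base + signed-sum σ diff)) ⊎ (base + ℤΣ.sum diff ≤ - + θ) →
               + ℕΣ.sum light + + θ ≤ + ℕΣ.sum (λ j → if toℕ j Nat.<ᵇ k then 0 else wv j)
                                      - + ℕΣ.sum (λ j → if toℕ j Nat.<ᵇ k then wv j else 0)
    conclude (inj₁ (σ , inside₁)) =
      let ε , inside₂ = window-walk θ (+_ ∘ light) _ light-window inside₁ in ⊥-elim (outside-window σ ε inside₂)
    conclude (inj₂ below₁) with window-walk-or-undershoot θ (+_ ∘ light) (base + ℤΣ.sum diff) light-window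
                                                           (ZP.≤-<-trans below₁ -θ<θ)
    ... | inj₁ (ε , inside₂) = ⊥-elim (outside-window (const true) ε inside₂)
    ... | inj₂ below₂ =
      subst₂ (λ b t → + ℕΣ.sum light + + θ ≤ + b - + t) (sym bottom≡) (sym top≡)
        (subst (λ z → + ℕΣ.sum light + + θ ≤ z - + top) (sym (ZP.pos-+ bottom leftover))
          (rearrange (+ leftover) (+ top) (+ bottom) (+ ℕΣ.sum light) (+ θ)
            (subst (_≤ - + θ) (cong₂ (λ d l → (base + d) + l) diff-sum (sym (ℤΣ.pos-sum light))) below₂)))

module IndependentSet (D : Digraph) (X : VSet D) (indep : Independent D X) where
  open Int using (_+_; _-_; _≤_)
  private
    N : ℕ
    N = n D
    Y : VSet D
    Y = compl {D} X
    a : Fin N → Fin N → ℕ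
    a i j = b2n (arc D i j)

  e-from-subset : ∀ P → _⊆_ {D} P X → e D P Y ≡ ℕΣ.sum (λ x → if P x then outdeg D x else 0)
  e-from-subset P P⊆X = begin
    e D P Y                                                  ≡⟨ e≡sum² D P Y ⟩
    sum² (λ i j → b2n (P i ∧ not (X j) ∧ arc D i j))        ≡⟨ ℕΣ.sum-cong-≗ (λ i → ℕΣ.sum-cong-≗ (λ j → cell (P i) (X j) (arc D i j) (λ Pi Xj → indep i j (P⊆X i Pi) Xj))) ⟩
    ℕΣ.sum (λ i → ℕΣ.sum (λ j → if P i then a i j else 0))  ≡⟨ ℕΣ.sum-cong-≗ (λ i → trans (ℕΣ.sum-if (P i) (a i)) (cong (λ t → if P i then t else 0) (sym (ℕΣ.Σ[]≡sum (a i))))) ⟩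
    ℕΣ.sum (λ x → if P x then outdeg D x else 0)            ∎
    where
    open ≡-Reasoning
    cell : ∀ p x b → (p ≡ true → x ≡ true → b ≡ false) → b2n (p ∧ not x ∧ b) ≡ (if p then b2n b else 0)
    cell true  true  true  no-arc with () ← no-arc refl refl
    cell true  true  false _ = refl
    cell true  false b     _ = refl
    cell false x     b     _ = refl

  e-to-subset : ∀ P → _⊆_ {D} P X → e D Y P ≡ ℕΣ.sum (λ x → if P x then indeg D x else 0)
  e-to-subset P P⊆X = begin
    e D Y P                                                  ≡⟨ e≡sum² D Y P ⟩
    sum² (λ i j → b2n (not (X i) ∧ P j ∧ arc D i j))        ≡⟨ ℕΣ.sum-cong-≗ (λ i → ℕΣ.sum-cong-≗ (λ j → cell (P j) (X i) (arc D i j) (λ Pj Xi → indep i j Xi (P⊆X j Pj)))) ⟩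
    ℕΣ.sum (λ i → ℕΣ.sum (λ j → if P j then a i j else 0))  ≡⟨ ℕΣ.∑-comm (λ i j → if P j then a i j else 0) ⟩
    ℕΣ.sum (λ j → ℕΣ.sum (λ i → if P j then a i j else 0))  ≡⟨ ℕΣ.sum-cong-≗ (λ j → trans (ℕΣ.sum-if (P j) (λ i → a i j)) (cong (λ t → if P j then t else 0) (sym (ℕΣ.Σ[]≡sum (λ i → a i j))))) ⟩
    ℕΣ.sum (λ x → if P x then indeg D x else 0)             ∎
    where
    open ≡-Reasoning
    cell : ∀ p x b → (p ≡ true → x ≡ true → b ≡ false) → b2n (not x ∧ p ∧ b) ≡ (if p then b2n b else 0)
    cell true  true  true  no-arc with () ← no-arc refl refl
    cell true  true  false _ = refl
    cell true  false b     _ = refl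
    cell false true  b     _ = refl
    cell false false b     _ = refl

  private
    pos-minus : ∀ {o i} → i Nat.≤ o → + o - + i ≡ + Nat.∣ o - i ∣
    pos-minus {o} {i} i≤o = trans (ZP.[+m]-[+n]≡m⊖n o i) (trans (ZP.⊖-≥ i≤o) (cong +_ (sym (NP.m≤n⇒∣n-m∣≡n∸m i≤o))))

    -- x goes to X₁ exactly when its sign S agrees with that of outdeg − indeg
    signed-cell : ∀ S o i → let c = if S then i Nat.≤ᵇ o else not (i Nat.≤ᵇ o) in
      (+ (if c then o else 0) + + (if not c then i else 0)) - (+ (if not c then o else 0) + + (if c then i else 0))
      ≡ signed S (+ Nat.∣ o - i ∣)
    signed-cell S o i with i Nat.≤ᵇ o in i≤ᵇo | S
    ... | true  | true  = trans (lemma (+ o) (+ i)) (pos-minus i≤o)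
      where
      i≤o : i Nat.≤ o
      i≤o = NP.≤ᵇ⇒≤ i o (subst T (sym i≤ᵇo) _)
      lemma : ∀ o i → (o + + 0) - (+ 0 + i) ≡ o - i
      lemma = IntSolver.solve-∀
    ... | true  | false = trans (lemma (+ o) (+ i)) (cong -_ (pos-minus i≤o))
      where
      i≤o : i Nat.≤ o
      i≤o = NP.≤ᵇ⇒≤ i o (subst T (sym i≤ᵇo) _)
      lemma : ∀ o i → (+ 0 + i) - (o + + 0) ≡ - (o - i)
      lemma = IntSolver.solve-∀
    ... | false | true  = trans (lemma (+ o) (+ i)) (trans (pos-minus {i} {o} o≤i) (cong +_ (NP.∣-∣-comm i o)))
      where
      o≤i : o Nat.≤ i
      o≤i = NP.<⇒≤ (NP.≰⇒> (λ i≤o → subst T i≤ᵇo (NP.≤⇒≤ᵇ i≤o)))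
      lemma : ∀ o i → (+ 0 + i) - (o + + 0) ≡ i - o
      lemma = IntSolver.solve-∀
    ... | false | false = trans (lemma (+ o) (+ i)) (cong -_ (trans (pos-minus {i} {o} o≤i) (cong +_ (NP.∣-∣-comm i o))))
      where
      o≤i : o Nat.≤ i
      o≤i = NP.<⇒≤ (NP.≰⇒> (λ i≤o → subst T i≤ᵇo (NP.≤⇒≤ᵇ i≤o)))
      lemma : ∀ o i → (o + + 0) - (+ 0 + i) ≡ - (i - o)
      lemma = IntSolver.solve-∀

  gap-as-signing : ∀ S → Σ (VSet D) λ X₁ → (_⊆_ {D} X₁ X) × (gap D X X₁ ≡ weighted-signing X (s D) S)
  gap-as-signing S = X₁ , (λ i → first-true) , (begin
    gap D X X₁
      ≡⟨ cong₂ _-_ (cong₂ (λ p q → + p + + q) (e-from-subset X₁ (λ i → first-true)) (e-to-subset X₂ (λ i → first-true)))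
                   (cong₂ (λ p q → + p + + q) (e-from-subset X₂ (λ i → first-true)) (e-to-subset X₁ (λ i → first-true))) ⟩
    (+ ℕΣ.sum (out X₁) + + ℕΣ.sum (in′ X₂)) - (+ ℕΣ.sum (out X₂) + + ℕΣ.sum (in′ X₁))
      ≡⟨ cong₂ _-_ (ℤΣ.pos-sum-+ (out X₁) (in′ X₂)) (ℤΣ.pos-sum-+ (out X₂) (in′ X₁)) ⟩
    ℤΣ.sum (λ x → + out X₁ x + + in′ X₂ x) - ℤΣ.sum (λ x → + out X₂ x + + in′ X₁ x)
      ≡⟨ ℤΣ.sum-minus (λ x → + out X₁ x + + in′ X₂ x) (λ x → + out X₂ x + + in′ X₁ x) ⟩
    ℤΣ.sum (λ x → (+ out X₁ x + + in′ X₂ x) - (+ out X₂ x + + in′ X₁ x))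
      ≡⟨ ℤΣ.sum-cong-≗ cell ⟩
    weighted-signing X (s D) S
      ∎)
    where
    open ≡-Reasoning
    X₁ X₂ : VSet D
    X₁ x = X x ∧ (if S x then indeg D x Nat.≤ᵇ outdeg D x else not (indeg D x Nat.≤ᵇ outdeg D x))
    X₂ = _∖_ {D} X X₁
    first-true : ∀ {b c} → b ∧ c ≡ true → b ≡ true
    first-true {true} _ = refl
    out in′ : VSet D → Fin N → ℕ
    out P x = if P x then outdeg D x else 0
    in′ P x = if P x then indeg D x else 0
    cell : ∀ x → (+ out X₁ x + + in′ X₂ x) - (+ out X₂ x + + in′ X₁ x) ≡ (if X x then signed (S x) (+ s D x) else + 0)
    cell x with X x
    ... | true  = signed-cell (S x) (outdeg D x) (indeg D x)
    ... | false = refl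

  card-Y : ℕ
  card-Y = ℕΣ.sum (λ j → b2n (not (X j)))

  s≤card-Y : ∀ x → X x ≡ true → s D x Nat.≤ card-Y
  s≤card-Y x Xx = NP.≤-trans (NP.∣m-n∣≤m⊔n (outdeg D x) (indeg D x)) (NP.⊔-lub out≤ in≤)
    where
    arc-into-Y : ∀ b y → (y ≡ true → b ≡ false) → b2n b Nat.≤ b2n (not y)
    arc-into-Y true  true  no-arc with () ← no-arc refl
    arc-into-Y true  false _ = NP.≤-refl
    arc-into-Y false y     _ = z≤n
    out≤ : outdeg D x Nat.≤ card-Y
    out≤ = subst (Nat._≤ card-Y) (sym (ℕΣ.Σ[]≡sum (a x)))
             (ℕΣ.sum-mono-≤ (λ j → arc-into-Y (arc D x j) (X j) (indep x j Xx)))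
    in≤ : indeg D x Nat.≤ card-Y
    in≤ = subst (Nat._≤ card-Y) (sym (ℕΣ.Σ[]≡sum (λ j → a j x)))
             (ℕΣ.sum-mono-≤ (λ j → arc-into-Y (arc D j x) (X j) (λ Xj → indep j x Xj Xx)))

  d*card-Y≤m : ∀ d → (∀ y → d Nat.≤ outdeg D y) → d Nat.* card-Y Nat.≤ arcs D
  d*card-Y≤m d d≤out = begin
    d Nat.* card-Y                          ≡⟨ ℕΣ.*-distribˡ-sum d (λ j → b2n (not (X j))) ⟩
    ℕΣ.sum (λ j → d Nat.* b2n (not (X j)))  ≤⟨ ℕΣ.sum-mono-≤ (λ j → cell j (X j)) ⟩
    ℕΣ.sum (outdeg D)                       ≡⟨ trans (ℕΣ.sum-cong-≗ (λ j → ℕΣ.Σ[]≡sum (a j))) (sym (e≡sum² D (full D) (full D))) ⟩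
    arcs D                                  ∎
    where
    open NP.≤-Reasoning
    cell : ∀ j b → d Nat.* b2n (not b) Nat.≤ outdeg D j
    cell j true  = subst (Nat._≤ outdeg D j) (sym (NP.*-zeroʳ d)) z≤n
    cell j false = subst (Nat._≤ outdeg D j) (sym (NP.*-identityʳ d)) (d≤out j)

  s<2θ : ∀ θ d → (∀ y → d Nat.≤ outdeg D y) → arcs D Nat.< θ Nat.* (2 Nat.* d ∸ 1) →
         ∀ x → X x ≡ true → s D x Nat.< 2 Nat.* θ
  s<2θ θ d d≤out m<θw x Xx = NP.*-cancelˡ-< d (s D x) (2 Nat.* θ) (begin-strict
    d Nat.* s D x                  ≤⟨ NP.*-monoʳ-≤ d (s≤card-Y x Xx) ⟩
    d Nat.* card-Y                 ≤⟨ d*card-Y≤m d d≤out ⟩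
    arcs D                         <⟨ m<θw ⟩
    θ Nat.* (2 Nat.* d ∸ 1)        ≤⟨ NP.*-monoʳ-≤ θ (NP.m∸n≤m (2 Nat.* d) 1) ⟩
    θ Nat.* (2 Nat.* d)            ≡⟨ swap θ d ⟩
    d Nat.* (2 Nat.* θ)            ∎)
    where
    open NP.≤-Reasoning
    swap : ∀ θ d → θ Nat.* (2 Nat.* d) ≡ d Nat.* (2 Nat.* θ)
    swap = NatSolver.solve-∀

module _ where
  open Nat using (_≤_; _<_; _*_; _+_)

  unbalanced-cond23 : (D : Digraph) (d : ℕ) (X : VSet D) (θ : ℕ) → Independent D X → IsMinGap D X θ →
    (∀ y → d ≤ outdeg D y) → arcs D < θ * (2 * d ∸ 1) → Cond23 D X θ
  unbalanced-cond23 D d X θ indep min-gap d≤out m<θw =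
    by-parity (proj₁ heavy-enumeration) (proj₂ heavy-enumeration) (even-or-odd (proj₁ heavy-enumeration))
    where
    open IndependentSet D X indep
    0<θ : ∀ {t w} → arcs D < t * w → 0 < t
    0<θ {zero}  ()
    0<θ {suc _} _ = s≤s z≤n
    unbalanced : ∀ S → θ ≤ Int.∣ weighted-signing X (s D) S ∣
    unbalanced S = let X₁ , X₁⊆X , gap≡ = gap-as-signing S in subst (θ ≤_) (cong Int.∣_∣ gap≡) (proj₂ min-gap X₁ X₁⊆X)
    open HeavyPairing X (s D) θ (0<θ m<θw) (s<2θ θ d d≤out m<θw) unbalanced
    heavy-enumeration : Σ ℕ λ c → (c ≡ ℕΣ.sum (b2n ∘ heavy)) × Σ (Fin c → Fin (n D)) (IsEnumeration heavy)
    heavy-enumeration = enumerate heavy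
    by-parity : ∀ c → (c ≡ ℕΣ.sum (b2n ∘ heavy)) × Σ (Fin c → Fin (n D)) (IsEnumeration heavy) →
                (∃ λ k → (c ≡ 2 * k + 0) ⊎ (c ≡ 2 * k + 1)) → Cond23 D X θ
    by-parity c (_ , enumeration) (k , inj₁ c≡2k) =
      let v , v-enumerates = subst (λ c → Σ (Fin c → Fin (n D)) (IsEnumeration heavy)) c≡2k enumeration
      in  ⊥-elim (no-even-enumeration k v v-enumerates)
    by-parity c (c≡ , _) (k , inj₂ c≡2k+1) =
      k , trans (ℕΣ.Σ[]≡sum (b2n ∘ heavy)) (trans (sym c≡) c≡2k+1) ,
      λ v (injective , inside , onto , _) →
        let top    = λ j → if toℕ j Nat.<ᵇ k then s D (v j) else 0
            bottom = λ j → if toℕ j Nat.<ᵇ k then 0 else s D (v j)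
        in  subst₂ (λ g b → + g Int.+ + θ Int.≤ + b Int.- + Σ[ top ]) (sym (ℕΣ.Σ[]≡sum light)) (sym (ℕΣ.Σ[]≡sum bottom))
              (subst (λ t → + ℕΣ.sum light Int.+ + θ Int.≤ + ℕΣ.sum bottom Int.- + t) (sym (ℕΣ.Σ[]≡sum top))
                (odd-enumeration-bound k v (injective , inside , onto)))

  balanced-good-cut : (D : Digraph) (d : ℕ) (X : VSet D) (θ : ℕ) (ε : ℚ) → Independent D X → IsMinGap D X θ →
    1 ≤ d → Positive ε → (∀ y → X y ≡ false → ℚ[ 4 ] ℚ.* ℚ[ deg D y ] ℚ.≤ ε ℚ.* ε ℚ.* ℚ[ arcs D ]) →
    θ * (2 * d ∸ 1) ≤ arcs D → Σ (VSet D) (GoodCut D d ε)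
  balanced-good-cut D d X θ ε indep ((X₁ , X₁⊆X , ∣gap∣≡θ) , _) 1≤d ε>0 small-degrees θw≤m =
    V , cut-bound m θ d M (e D V (compl {D} V)) g ε ε>0 1≤d -θ≤g (proj₁ (proj₂ near)) 4M≤ θw≤m
      , cut-bound m θ d M (e D (compl {D} V) V) (- g) ε ε>0 1≤d -θ≤-g (proj₂ (proj₂ near)) 4M≤ θw≤m
    where
    m : ℕ
    m = arcs D
    g : ℤ
    g = gap D X X₁
    small : ℕ → Set
    small M = ℚ[ 4 ] ℚ.* ℚ[ M ] ℚ.≤ ε ℚ.* ε ℚ.* ℚ[ m ]
    small-0 : small 0
    small-0 = subst (ℚ._≤ ε ℚ.* ε ℚ.* ℚ[ m ]) (sym (QP.*-zeroʳ ℚ[ 4 ]))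
                    (*-nonneg (*-nonneg (QP.<⇒≤ (QP.positive⁻¹ ε {{ε>0}})) (QP.<⇒≤ (QP.positive⁻¹ ε {{ε>0}}))) (ℚ[]-nonneg m))
    Y-degree : Fin (n D) → ℕ
    Y-degree y = if X y then 0 else deg D y
    small-Y : ∀ y → small (Y-degree y)
    small-Y y with X y in Xy
    ... | true  = small-0
    ... | false = small-degrees y Xy
    bound : Σ ℕ λ M → small M × (∀ y → Y-degree y ≤ M)
    bound = uniform-bound small Y-degree small-0 small-Y
    M : ℕ
    M = proj₁ bound
    4M≤ : small M
    4M≤ = proj₁ (proj₂ bound)
    deg≤M : ∀ y → X y ≡ false → deg D y ≤ M
    deg≤M y Xy = subst (_≤ M) (cong (λ b → if b then 0 else deg D y) Xy) (proj₂ (proj₂ bound) y)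
    near : Σ (VSet D) (NearExpected D X X₁ M)
    near = near-expected-cuts D X X₁ M indep X₁⊆X deg≤M
    V = proj₁ near
    -∣∣≤ : ∀ z → - + Int.∣ z ∣ Int.≤ z
    -∣∣≤ (+ k)        = ZP.neg-≤-pos
    -∣∣≤ Int.-[1+ k ] = ZP.≤-refl
    -θ≤g : - + θ Int.≤ g
    -θ≤g = subst (λ t → - + t Int.≤ g) ∣gap∣≡θ (-∣∣≤ g)
    -θ≤-g : - + θ Int.≤ - g
    -θ≤-g = subst (λ t → - + t Int.≤ - g) (trans (ZP.∣-i∣≡∣i∣ g) ∣gap∣≡θ) (-∣∣≤ (- g))

open import Data.Nat using (_≤_; _<_; _*_)

lemma3p1 : (D : Digraph) (d : ℕ) (X : VSet D) (θ : ℕ) (ε : ℚ) →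
    MinOutdeg D d → 4 ≤ d →
    e D X X ≡ 0 →
    IsMinGap D X θ →
    Positive ε →
    (∀ y → X y ≡ false → ℚ[ 4 ] ℚ.* ℚ[ deg D y ] ℚ.≤ ε ℚ.* ε ℚ.* ℚ[ arcs D ]) →
    (Σ (VSet D) λ V₁ → GoodCut D d ε V₁)
    ⊎ ((arcs D < θ * (2 * d ∸ 1)) × Cond23 D X θ)
lemma3p1 D d X θ ε (d≤out , _) 4≤d eXX≡0 min-gap ε>0 small-degrees with arcs D Nat.<? θ * (2 * d ∸ 1)
... | yes m<θw = inj₂ (m<θw , unbalanced-cond23 D d X θ indep min-gap d≤out m<θw)
  where
  indep : Independent D X
  indep = e≡0⇒independent D X eXX≡0
... | no  m≮θw = inj₁ (balanced-good-cut D d X θ ε indep min-gap (NP.≤-trans (s≤s z≤n) 4≤d) ε>0 small-degrees (NP.≮⇒≥ m≮θw))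
  where
  indep : Independent D X
  indep = e≡0⇒independent D X eXX≡0
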